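{- For every integer $n\geq 1$, \[ C_{4}(n)=\sum_{k\geq 1}(-1)^{k(k+1)/2+1}\,C_{4}\big(n-k(k+1)/2\big). \]
   Context: $C_4(n)$ is the number of partitions of $n$ into parts not congruent to $2$ modulo $4$, with $C_4(0)=1$ and $C_4(m)=0$ for $m<0$. -}

module Defs where

open import Data.Nat using (ℕ; zero; suc; _+_; _*_; _∸_; _%_; _≤?_; _≟_; _/_)
open import Data.Integer as ℤ using (ℤ)
open import Data.List using (List; []; _∷_; _++_; length; filter; map; concatMap; sum; upTo; applyUpTo; replicate)
open import Data.List.Relation.Unary.All using (All; all?)
open import Relation.Nullary using (¬_; ¬?; yes; no)
open import Relation.Binary.PropositionalEquality using (_≡_)

-- partsLE m n : every partition of n into positive parts of size ≤ m,
-- each listed exactly once as a non-increasing list of parts.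
-- (Recursion on m: choose the multiplicity j of the part m+1.)
partsLE : ℕ → ℕ → List (List ℕ)
partsLE zero zero = [] ∷ []
partsLE zero (suc _) = []
partsLE (suc m) n = concatMap choose (upTo (suc n))
  where
  choose : ℕ → List (List ℕ)
  choose j with j * suc m ≤? n
  ... | yes _ = map (replicate j (suc m) ++_) (partsLE m (n ∸ j * suc m))
  ... | no _  = []

partitions : ℕ → List (List ℕ)
partitions n = partsLE n n

Allowed : ℕ → Set
Allowed p = ¬ (p % 4 ≡ 2)

C4 : ℕ → ℕ
C4 n = length (filter (all? (λ p → ¬? (p % 4 ≟ 2))) (partitions n))

C4ℤ : ℤ → ℕ
C4ℤ (ℤ.+ n) = C4 n
C4ℤ ℤ.-[1+ _ ] = 0

tri : ℕ → ℕ
tri k = (k * suc k) / 2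

sgn : ℕ → ℤ
sgn e with e % 2
... | zero = ℤ.+ 1
... | suc _ = ℤ.- (ℤ.+ 1)

sumFrom1 : ℕ → (ℕ → ℤ) → ℤ
sumFrom1 zero f = ℤ.+ 0
sumFrom1 (suc K) f = sumFrom1 K f ℤ.+ f (suc K)

-- With P = ∏_{j ≢ 2 (mod 4)} (1 - qʲ)⁻¹ = Σₙ C₄(n) qⁿ, the recurrence says that
-- Σ_{k ≥ 0} (-1)^{k(k+1)/2} q^{k(k+1)/2} · P = 1.  Pairing k = 2d - 1 with k = 2d, the first
-- factor is Σ_{j ∈ ℤ} (-1)ʲ q^{j + 2j²}.  The finite triple product identity
--   Σ_{a ≤ m+n} (-1)ᵃ q^{a + 2(a-n)²} [m+n, a]_{q⁴} = (-1)ⁿ qⁿ (q³;q⁴)ₘ (q;q⁴)ₙ,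
-- which follows by induction from the two Pascal rules for Gaussian binomials, gives at
-- m = n = N, after multiplying by (q⁴;q⁴)_N to make the Gaussian binomials 1 in low degree,
--   Σ_{a ≤ 2N} (-1)ᵃ q^{a + 2(a-N)²} ≡ (-1)ᴺ qᴺ ∏_{j ≤ 4N, j ≢ 2 (mod 4)} (1 - qʲ)   (mod q^{2N+1}).
-- Dividing by the product and comparing coefficients of q^{2N} gives the recurrence, the
-- indices a = N - d and a = N + d contributing the terms k = 2d - 1 and k = 2d.

module Submission where

open import Defs
open import Data.Nat as ℕ
  using (ℕ; zero; suc; _+_; _∸_; _≤_; _<_; z≤n; s≤s; pred; _%_; _≟_; ∣_-_∣)
import Data.Nat.Properties as ℕₚ
import Data.Nat.DivMod as DM
open import Data.Integer as ℤ using (ℤ; +_; -_; _-_; _*_; _^_; 0ℤ; 1ℤ; -1ℤ)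
import Data.Integer.Properties as ℤₚ
import Data.Integer.Tactic.RingSolver as ℤ-Solver
import Data.Nat.Tactic.RingSolver as ℕ-Solver
open import Data.List using (List; []; _∷_; _++_; length; filter; map; concatMap; replicate; upTo; applyUpTo)
open import Data.List.Properties using (length-++; filter-++; concatMap-cong)
open import Data.List.Relation.Unary.All using (All; _∷_; all?)
import Data.List.Relation.Unary.All.Properties as All
open import Data.Empty using (⊥-elim)
open import Data.Sum using (inj₁; inj₂)
open import Function using (_∘_; id; _⇔_; mk⇔)
open import Relation.Nullary using (¬_; ¬?; Dec; yes; no)
open import Relation.Nullary.Decidable using (does-⇔)
open import Relation.Binary.PropositionalEquality
open import Relation.Binary.Bundles using (Setoid)
open import Algebra.Properties.CommutativeSemigroup ℤₚ.+-commutativeSemigroup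
  using () renaming (interchange to +-interchange)
import Relation.Binary.Reasoning.Setoid as SetoidReasoning

-- Formal power series

Series : Set
Series = ℕ → ℤ

private
  variable
    m n t M N : ℕ
    f f′ g g′ h : Series
    F G : ℕ → Series
    α β : ℕ → ℤ
    z : ℤ

open Setoid (ℕ →-setoid ℤ)
  using () renaming (refl to ≗-refl; sym to ≗-sym; trans to ≗-trans)
module ≗-Reasoning = SetoidReasoning (ℕ →-setoid ℤ)

infix 4 _≗[<_]_
_≗[<_]_ : Series → ℕ → Series → Set
f ≗[< M ] g = ∀ t → t < M → f t ≡ g t

≗⇒≗[<] : f ≗ g → f ≗[< M ] g
≗⇒≗[<] f≗g t _ = f≗g t

≗[<]-sym : f ≗[< M ] g → g ≗[< M ] f
≗[<]-sym f≗g t t<M = sym (f≗g t t<M)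

≗[<]-trans : f ≗[< M ] g → g ≗[< M ] h → f ≗[< M ] h
≗[<]-trans f≗g g≗h t t<M = trans (f≗g t t<M) (g≗h t t<M)

≗[<]-weaken : N ≤ M → f ≗[< M ] g → f ≗[< N ] g
≗[<]-weaken N≤M f≗g t t<N = f≗g t (ℕₚ.<-≤-trans t<N N≤M)

one : Series
one zero    = 1ℤ
one (suc _) = 0ℤ

infixl 6 _⊕_
_⊕_ : Series → Series → Series
(f ⊕ g) t = f t ℤ.+ g t

infixr 8 _⊙_
_⊙_ : ℤ → Series → Series
(z ⊙ f) t = z * f t

infixr 8 q^_·_ 1-q^_·_
q^_·_ : ℕ → Series → Series
(q^ zero  · f) t       = f t
(q^ suc k · f) zero    = 0ℤ
(q^ suc k · f) (suc t) = (q^ k · f) t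

1-q^_·_ : ℕ → Series → Series
1-q^ m · f = f ⊕ -1ℤ ⊙ q^ m · f

⊕-cong : f ≗ f′ → g ≗ g′ → f ⊕ g ≗ f′ ⊕ g′
⊕-cong f≗f′ g≗g′ t = cong₂ ℤ._+_ (f≗f′ t) (g≗g′ t)

⊕-congˡ : ∀ f → g ≗ g′ → f ⊕ g ≗ f ⊕ g′
⊕-congˡ f g≗g′ t = cong (λ x → f t ℤ.+ x) (g≗g′ t)

⊕-congʳ : ∀ g → f ≗ f′ → f ⊕ g ≗ f′ ⊕ g
⊕-congʳ g f≗f′ t = cong (ℤ._+ g t) (f≗f′ t)

⊙-cong : ∀ z → f ≗ g → z ⊙ f ≗ z ⊙ g
⊙-cong z f≗g t = cong (z *_) (f≗g t)

⊙-assoc : ∀ x y f → x ⊙ y ⊙ f ≗ (x * y) ⊙ f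
⊙-assoc x y f t = sym (ℤₚ.*-assoc x y (f t))

⊕-assoc : ∀ f g h → (f ⊕ g) ⊕ h ≗ f ⊕ (g ⊕ h)
⊕-assoc f g h t = ℤₚ.+-assoc (f t) (g t) (h t)

⊕-comm : ∀ f g → f ⊕ g ≗ g ⊕ f
⊕-comm f g t = ℤₚ.+-comm (f t) (g t)

⊕-interchange : ∀ f g h h′ → (f ⊕ g) ⊕ (h ⊕ h′) ≗ (f ⊕ h) ⊕ (g ⊕ h′)
⊕-interchange f g h h′ t = +-interchange (f t) (g t) (h t) (h′ t)

q^-≡ : ∀ {i j} f → i ≡ j → q^ i · f ≗ q^ j · f
q^-≡ f refl = ≗-refl

⊙-identityˡ : ∀ f → 1ℤ ⊙ f ≗ f
⊙-identityˡ f t = ℤₚ.*-identityˡ (f t)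

q^-cong : ∀ k → f ≗ g → q^ k · f ≗ q^ k · g
q^-cong zero    f≗g t       = f≗g t
q^-cong (suc k) f≗g zero    = refl
q^-cong (suc k) f≗g (suc t) = q^-cong k f≗g t

q^-below : ∀ {k} → t < k → (q^ k · f) t ≡ 0ℤ
q^-below {zero}  {k = suc k} _         = refl
q^-below {suc t} {k = suc k} (s≤s t<k) = q^-below {t} {k = k} t<k

q^-at : ∀ k f s → (q^ k · f) (k + s) ≡ f s
q^-at zero    f s = refl
q^-at (suc k) f s = q^-at k f s

q^-above : ∀ {k} → k ≤ t → (q^ k · f) t ≡ f (t ∸ k)
q^-above {t} {f} {k} k≤t = begin
  (q^ k · f) t             ≡⟨ cong (q^ k · f) (sym (ℕₚ.m+[n∸m]≡n k≤t)) ⟩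
  (q^ k · f) (k + (t ∸ k)) ≡⟨ q^-at k f (t ∸ k) ⟩
  f (t ∸ k)                ∎
  where open ≡-Reasoning

q^-+ : ∀ j k f → q^ (j + k) · f ≗ q^ j · q^ k · f
q^-+ zero    k f t       = refl
q^-+ (suc j) k f zero    = refl
q^-+ (suc j) k f (suc t) = q^-+ j k f t

q^-comm : ∀ j k f → q^ j · q^ k · f ≗ q^ k · q^ j · f
q^-comm j k f = begin
  q^ j · q^ k · f ≈⟨ ≗-sym (q^-+ j k f) ⟩
  q^ (j + k) · f  ≡⟨ cong (q^_· f) (ℕₚ.+-comm j k) ⟩
  q^ (k + j) · f  ≈⟨ q^-+ k j f ⟩
  q^ k · q^ j · f ∎
  where open ≗-Reasoning

q^-⊕ : ∀ k f g → q^ k · (f ⊕ g) ≗ q^ k · f ⊕ q^ k · g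
q^-⊕ zero    f g t       = refl
q^-⊕ (suc k) f g zero    = refl
q^-⊕ (suc k) f g (suc t) = q^-⊕ k f g t

q^-⊙ : ∀ k z f → q^ k · z ⊙ f ≗ z ⊙ q^ k · f
q^-⊙ zero    z f t       = refl
q^-⊙ (suc k) z f zero    = sym (ℤₚ.*-zeroʳ z)
q^-⊙ (suc k) z f (suc t) = q^-⊙ k z f t

q^-causal : ∀ k → f ≗[< M ] g → q^ k · f ≗[< k + M ] q^ k · g
q^-causal zero    f≗g t       t<M       = f≗g t t<M
q^-causal (suc k) f≗g zero    _         = refl
q^-causal (suc k) f≗g (suc t) (s≤s t<M) = q^-causal k f≗g t t<M

1-q^-below : ∀ m f → 1-q^ m · f ≗[< m ] f
1-q^-below m f t t<m = begin
  f t ℤ.+ -1ℤ * (q^ m · f) t ≡⟨ cong (λ x → f t ℤ.+ -1ℤ * x) (q^-below t<m) ⟩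
  f t ℤ.+ -1ℤ * 0ℤ           ≡⟨ ℤₚ.+-identityʳ (f t) ⟩
  f t                        ∎
  where open ≡-Reasoning

1-q^-injective : 1-q^ suc m · f ≗[< M ] 1-q^ suc m · g → f ≗[< M ] g
1-q^-injective {m} {f} {M} {g} eq t t<M = agree (suc t) t<M t ℕₚ.≤-refl
  where
  -- fₜ = ((1 - q^{m+1}) f)ₜ + f_{t-m-1}, so f is recovered degree by degree.
  recover : ∀ x y → x ≡ (x ℤ.+ - + 1 * y) ℤ.+ y
  recover = ℤ-Solver.solve-∀
  agree : ∀ n → n ≤ M → f ≗[< n ] g
  agree (suc n) n<M t (s≤s t≤n) = begin
    f t                                                ≡⟨ recover (f t) _ ⟩
    (1-q^ suc m · f) t ℤ.+ (q^ suc m · f) t            ≡⟨ cong₂ ℤ._+_ (eq t (ℕₚ.≤-<-trans t≤n n<M))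
                                                            (q^-causal (suc m) (agree n (ℕₚ.<⇒≤ n<M)) t
                                                               (s≤s (ℕₚ.≤-trans t≤n (ℕₚ.m≤n+m n m)))) ⟩
    (1-q^ suc m · g) t ℤ.+ (q^ suc m · g) t            ≡⟨ recover (g t) _ ⟨
    g t                                                ∎
    where open ≡-Reasoning

-- An operator that acts as multiplication by a fixed power series: ℤ-linear, commuting
-- with q, and causal (coefficients below qᴹ of the image depend only on those of the argument).
record Multiplier (O : Series → Series) : Set where
  field
    ≗-cong : f ≗ g → O f ≗ O g
    ⊕-homo : ∀ f g → O (f ⊕ g) ≗ O f ⊕ O g
    ⊙-homo : ∀ z f → O (z ⊙ f) ≗ z ⊙ O f
    q^-homo : ∀ k f → O (q^ k · f) ≗ q^ k · O f
    causal : f ≗[< M ] g → O f ≗[< M ] O g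

open Multiplier

id-multiplier : Multiplier id
id-multiplier = record
  { ≗-cong = id
  ; ⊕-homo = λ _ _ _ → refl
  ; ⊙-homo = λ _ _ _ → refl
  ; q^-homo = λ _ _ _ → refl
  ; causal = id
  }

∘-multiplier : ∀ {O P} → Multiplier O → Multiplier P → Multiplier (O ∘ P)
∘-multiplier {O} {P} μ ν = record
  { ≗-cong = ≗-cong μ ∘ ≗-cong ν
  ; ⊕-homo = λ f g → ≗-trans (≗-cong μ (⊕-homo ν f g)) (⊕-homo μ (P f) (P g))
  ; ⊙-homo = λ z f → ≗-trans (≗-cong μ (⊙-homo ν z f)) (⊙-homo μ z (P f))
  ; q^-homo = λ k f → ≗-trans (≗-cong μ (q^-homo ν k f)) (q^-homo μ k (P f))
  ; causal = causal μ ∘ causal ν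
  }

q^-multiplier : ∀ j → Multiplier (q^ j ·_)
q^-multiplier j = record
  { ≗-cong = q^-cong j
  ; ⊕-homo = q^-⊕ j
  ; ⊙-homo = q^-⊙ j
  ; q^-homo = λ k f → q^-comm j k f
  ; causal = λ f≗g → ≗[<]-weaken (ℕₚ.m≤n+m _ j) (q^-causal j f≗g)
  }

⊙-multiplier : ∀ z → Multiplier (z ⊙_)
⊙-multiplier z = record
  { ≗-cong = ⊙-cong z
  ; ⊕-homo = λ f g t → ℤₚ.*-distribˡ-+ z (f t) (g t)
  ; ⊙-homo = λ y f → ≗-trans (⊙-assoc z y f)
                       (≗-trans (λ t → cong (_* f t) (ℤₚ.*-comm z y)) (≗-sym (⊙-assoc y z f)))
  ; q^-homo = λ k f → ≗-sym (q^-⊙ k z f)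
  ; causal = λ f≗g t t<M → cong (z *_) (f≗g t t<M)
  }

⊕-multiplier : ∀ {O P} → Multiplier O → Multiplier P → Multiplier (λ f → O f ⊕ P f)
⊕-multiplier {O} {P} μ ν = record
  { ≗-cong = λ f≗g → ⊕-cong (≗-cong μ f≗g) (≗-cong ν f≗g)
  ; ⊕-homo = λ f g t → trans (cong₂ ℤ._+_ (⊕-homo μ f g t) (⊕-homo ν f g t))
                              (+-interchange (O f t) (O g t) (P f t) (P g t))
  ; ⊙-homo = λ z f t → trans (cong₂ ℤ._+_ (⊙-homo μ z f t) (⊙-homo ν z f t))
                              (sym (ℤₚ.*-distribˡ-+ z (O f t) (P f t)))
  ; q^-homo = λ k f → ≗-trans (⊕-cong (q^-homo μ k f) (q^-homo ν k f)) (≗-sym (q^-⊕ k (O f) (P f)))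
  ; causal = λ f≗g t t<M → cong₂ ℤ._+_ (causal μ f≗g t t<M) (causal ν f≗g t t<M)
  }

1-q^-multiplier : ∀ m → Multiplier (1-q^ m ·_)
1-q^-multiplier m = ⊕-multiplier id-multiplier (∘-multiplier (⊙-multiplier -1ℤ) (q^-multiplier m))

1-q^-comm : ∀ {O} → Multiplier O → ∀ m f → O (1-q^ m · f) ≗ 1-q^ m · O f
1-q^-comm {O} μ m f = begin
  O (f ⊕ -1ℤ ⊙ q^ m · f)      ≈⟨ ⊕-homo μ f _ ⟩
  O f ⊕ O (-1ℤ ⊙ q^ m · f)    ≈⟨ ⊕-congˡ (O f) (≗-trans (⊙-homo μ -1ℤ _) (⊙-cong -1ℤ (q^-homo μ m f))) ⟩
  O f ⊕ -1ℤ ⊙ q^ m · O f      ∎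
  where open ≗-Reasoning

monomial-multiplier : ∀ z e → Multiplier (λ f → z ⊙ q^ e · f)
monomial-multiplier z e = ∘-multiplier (⊙-multiplier z) (q^-multiplier e)

q^-⊙q^ : ∀ i y j f → q^ i · y ⊙ q^ j · f ≗ y ⊙ q^ (i + j) · f
q^-⊙q^ i y j f = ≗-trans (q^-⊙ i y (q^ j · f)) (⊙-cong y (≗-sym (q^-+ i j f)))

⊙q^-⊙q^ : ∀ x i y j f → x ⊙ q^ i · y ⊙ q^ j · f ≗ (x * y) ⊙ q^ (i + j) · f
⊙q^-⊙q^ x i y j f = ≗-trans (⊙-cong x (q^-⊙q^ i y j f)) (⊙-assoc x y (q^ (i + j) · f))

monomial-comm : ∀ {O} → Multiplier O → ∀ z e f → O (z ⊙ q^ e · f) ≗ z ⊙ q^ e · O f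
monomial-comm μ z e f = ≗-trans (⊙-homo μ z (q^ e · f)) (⊙-cong z (q^-homo μ e f))

monomial-causal : ∀ z e → f ≗[< M ] g → z ⊙ q^ e · f ≗[< e + M ] z ⊙ q^ e · g
monomial-causal z e f≗g = causal (⊙-multiplier z) (q^-causal e f≗g)

sum≤ : ℕ → (ℕ → ℤ) → ℤ
sum≤ K u = u 0 ℤ.+ sumFrom1 K u

sumFrom1-cong : ∀ K → (∀ d → 1 ≤ d → d ≤ K → α d ≡ β d) → sumFrom1 K α ≡ sumFrom1 K β
sumFrom1-cong zero    α≡β = refl
sumFrom1-cong (suc K) α≡β = cong₂ ℤ._+_ (sumFrom1-cong K (λ d 1≤d d≤K → α≡β d 1≤d (ℕₚ.m≤n⇒m≤1+n d≤K)))
                                         (α≡β (suc K) (s≤s z≤n) ℕₚ.≤-refl)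

sum≤-cong : ∀ K → (∀ a → a ≤ K → α a ≡ β a) → sum≤ K α ≡ sum≤ K β
sum≤-cong K α≡β = cong₂ ℤ._+_ (α≡β 0 z≤n) (sumFrom1-cong K (λ a _ a≤K → α≡β a a≤K))

sumFrom1-zero : ∀ K → (∀ d → 1 ≤ d → d ≤ K → α d ≡ 0ℤ) → sumFrom1 K α ≡ 0ℤ
sumFrom1-zero zero    α≡0 = refl
sumFrom1-zero (suc K) α≡0 = begin
  sumFrom1 K _ ℤ.+ _ ≡⟨ cong₂ ℤ._+_ (sumFrom1-zero K (λ d 1≤d d≤K → α≡0 d 1≤d (ℕₚ.m≤n⇒m≤1+n d≤K)))
                                     (α≡0 (suc K) (s≤s z≤n) ℕₚ.≤-refl) ⟩
  0ℤ                 ∎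
  where open ≡-Reasoning

sumFrom1-+ : ∀ K u v → sumFrom1 K (λ d → u d ℤ.+ v d) ≡ sumFrom1 K u ℤ.+ sumFrom1 K v
sumFrom1-+ zero    u v = refl
sumFrom1-+ (suc K) u v = trans (cong (ℤ._+ (u (suc K) ℤ.+ v (suc K))) (sumFrom1-+ K u v))
                               (+-interchange (sumFrom1 K u) (sumFrom1 K v) (u (suc K)) (v (suc K)))

sumFrom1-* : ∀ K z u → sumFrom1 K (λ d → z * u d) ≡ z * sumFrom1 K u
sumFrom1-* zero    z u = sym (ℤₚ.*-zeroʳ z)
sumFrom1-* (suc K) z u = trans (cong (ℤ._+ z * u (suc K)) (sumFrom1-* K z u))
                               (sym (ℤₚ.*-distribˡ-+ z (sumFrom1 K u) (u (suc K))))

sumFrom1-suc : ∀ K u → sumFrom1 (suc K) u ≡ sum≤ K (u ∘ suc)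
sumFrom1-suc zero    u = trans (ℤₚ.+-identityˡ (u 1)) (sym (ℤₚ.+-identityʳ (u 1)))
sumFrom1-suc (suc K) u = trans (cong (ℤ._+ u (suc (suc K))) (sumFrom1-suc K u))
                               (ℤₚ.+-assoc (u 1) _ _)

sumFrom1-pred : ∀ K u → sumFrom1 K (u ∘ pred) ℤ.+ u K ≡ sum≤ K u
sumFrom1-pred zero    u = trans (ℤₚ.+-identityˡ (u 0)) (sym (ℤₚ.+-identityʳ (u 0)))
sumFrom1-pred (suc K) u = trans (cong (ℤ._+ u (suc K)) (sumFrom1-pred K u)) (ℤₚ.+-assoc (u 0) _ _)

sumFrom1-++ : ∀ K L u → sumFrom1 (K + L) u ≡ sumFrom1 K u ℤ.+ sumFrom1 L (λ d → u (K + d))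
sumFrom1-++ K zero    u = trans (cong (λ n → sumFrom1 n u) (ℕₚ.+-identityʳ K)) (sym (ℤₚ.+-identityʳ _))
sumFrom1-++ K (suc L) u = begin
  sumFrom1 (K + suc L) u                                            ≡⟨ cong (λ n → sumFrom1 n u) (ℕₚ.+-suc K L) ⟩
  sumFrom1 (K + L) u ℤ.+ u (suc (K + L))                            ≡⟨ cong₂ ℤ._+_ (sumFrom1-++ K L u)
                                                                          (cong u (sym (ℕₚ.+-suc K L))) ⟩
  (sumFrom1 K u ℤ.+ sumFrom1 L (λ d → u (K + d))) ℤ.+ u (K + suc L) ≡⟨ ℤₚ.+-assoc (sumFrom1 K u) _ _ ⟩
  sumFrom1 K u ℤ.+ sumFrom1 (suc L) (λ d → u (K + d))               ∎
  where open ≡-Reasoning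

sumFrom1-pairs : ∀ K u → sumFrom1 (K + K) u ≡ sumFrom1 K (λ d → u (pred (d + d)) ℤ.+ u (d + d))
sumFrom1-pairs zero    u = refl
sumFrom1-pairs (suc K) u = begin
  sumFrom1 (suc (K + suc K)) u
    ≡⟨ cong (λ n → sumFrom1 (suc n) u) (ℕₚ.+-suc K K) ⟩
  (sumFrom1 (K + K) u ℤ.+ u (suc (K + K))) ℤ.+ u (suc (suc (K + K)))
    ≡⟨ ℤₚ.+-assoc (sumFrom1 (K + K) u) _ _ ⟩
  sumFrom1 (K + K) u ℤ.+ (u (suc (K + K)) ℤ.+ u (suc (suc (K + K))))
    ≡⟨ cong₂ ℤ._+_ (sumFrom1-pairs K u) (cong (λ n → u (pred n) ℤ.+ u n) (cong suc (sym (ℕₚ.+-suc K K)))) ⟩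
  sumFrom1 (suc K) (λ d → u (pred (d + d)) ℤ.+ u (d + d))
    ∎
  where open ≡-Reasoning

sumFrom1-extend : ∀ K e u → (∀ d → 1 ≤ d → d ≤ e → u (K + d) ≡ 0ℤ) → sumFrom1 (K + e) u ≡ sumFrom1 K u
sumFrom1-extend K e u tail≡0 = begin
  sumFrom1 (K + e) u                                ≡⟨ sumFrom1-++ K e u ⟩
  sumFrom1 K u ℤ.+ sumFrom1 e (λ d → u (K + d))     ≡⟨ cong (λ x → sumFrom1 K u ℤ.+ x) (sumFrom1-zero e tail≡0) ⟩
  sumFrom1 K u ℤ.+ 0ℤ                               ≡⟨ ℤₚ.+-identityʳ _ ⟩
  sumFrom1 K u                                      ∎
  where open ≡-Reasoning

sum≤-extend : ∀ K e u → (∀ d → 1 ≤ d → d ≤ e → u (K + d) ≡ 0ℤ) → sum≤ (K + e) u ≡ sum≤ K u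
sum≤-extend K e u tail≡0 = cong (λ x → u 0 ℤ.+ x) (sumFrom1-extend K e u tail≡0)

sum≤-around-middle : ∀ N u → sum≤ (N + N) u ≡ u N ℤ.+ sumFrom1 N (λ d → u (N ∸ d) ℤ.+ u (N + d))
sum≤-around-middle N u = begin
  u 0 ℤ.+ sumFrom1 (N + N) u
    ≡⟨ cong (λ x → u 0 ℤ.+ x) (sumFrom1-++ N N u) ⟩
  u 0 ℤ.+ (sumFrom1 N u ℤ.+ sumFrom1 N (λ d → u (N + d)))
    ≡⟨ ℤₚ.+-assoc (u 0) _ _ ⟨
  sum≤ N u ℤ.+ sumFrom1 N (λ d → u (N + d))
    ≡⟨ cong (ℤ._+ sumFrom1 N (λ d → u (N + d))) (reverse N u) ⟩
  (u N ℤ.+ sumFrom1 N (λ d → u (N ∸ d))) ℤ.+ sumFrom1 N (λ d → u (N + d))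
    ≡⟨ ℤₚ.+-assoc (u N) _ _ ⟩
  u N ℤ.+ (sumFrom1 N (λ d → u (N ∸ d)) ℤ.+ sumFrom1 N (λ d → u (N + d)))
    ≡⟨ cong (λ x → u N ℤ.+ x) (sumFrom1-+ N _ _) ⟨
  u N ℤ.+ sumFrom1 N (λ d → u (N ∸ d) ℤ.+ u (N + d))
    ∎
  where
  open ≡-Reasoning
  reverse : ∀ N u → sum≤ N u ≡ u N ℤ.+ sumFrom1 N (λ d → u (N ∸ d))
  reverse zero    u = refl
  reverse (suc N) u = begin
    u 0 ℤ.+ (sumFrom1 N u ℤ.+ u (suc N))               ≡⟨ ℤₚ.+-assoc (u 0) _ _ ⟨
    sum≤ N u ℤ.+ u (suc N)                             ≡⟨ ℤₚ.+-comm (sum≤ N u) (u (suc N)) ⟩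
    u (suc N) ℤ.+ sum≤ N u                             ≡⟨ cong (λ x → u (suc N) ℤ.+ x) (reverse N u) ⟩
    u (suc N) ℤ.+ sum≤ N (λ d → u (N ∸ d))             ≡⟨ cong (λ x → u (suc N) ℤ.+ x) (sumFrom1-suc N _) ⟨
    u (suc N) ℤ.+ sumFrom1 (suc N) (λ d → u (suc N ∸ d)) ∎

sumₛ : ℕ → (ℕ → Series) → Series
sumₛ K F t = sum≤ K (λ a → F a t)

sumₛ-causal : ∀ K → (∀ a → a ≤ K → F a ≗[< M ] G a) → sumₛ K F ≗[< M ] sumₛ K G
sumₛ-causal K F≗G t t<M = sum≤-cong K (λ a a≤K → F≗G a a≤K t t<M)

sumₛ-cong : ∀ K → (∀ a → a ≤ K → F a ≗ G a) → sumₛ K F ≗ sumₛ K G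
sumₛ-cong K F≗G t = sumₛ-causal K (λ a a≤K → ≗⇒≗[<] (F≗G a a≤K)) t (ℕₚ.n<1+n t)

sumₛ-comm : ∀ {O} → Multiplier O → ∀ K F → O (sumₛ K F) ≗ sumₛ K (O ∘ F)
sumₛ-comm {O} μ zero    F = begin
  O (sumₛ 0 F)   ≈⟨ ≗-cong μ (λ t → ℤₚ.+-identityʳ (F 0 t)) ⟩
  O (F 0)        ≈⟨ (λ t → sym (ℤₚ.+-identityʳ (O (F 0) t))) ⟩
  sumₛ 0 (O ∘ F) ∎
  where open ≗-Reasoning
sumₛ-comm {O} μ (suc K) F = begin
  O (sumₛ (suc K) F)                  ≈⟨ ≗-cong μ (sumₛ-suc K F) ⟩
  O (sumₛ K F ⊕ F (suc K))            ≈⟨ ⊕-homo μ (sumₛ K F) (F (suc K)) ⟩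
  O (sumₛ K F) ⊕ O (F (suc K))        ≈⟨ ⊕-congʳ (O (F (suc K))) (sumₛ-comm μ K F) ⟩
  sumₛ K (O ∘ F) ⊕ O (F (suc K))      ≈⟨ sumₛ-suc K (O ∘ F) ⟨
  sumₛ (suc K) (O ∘ F)                ∎
  where
  open ≗-Reasoning
  sumₛ-suc : ∀ K F → sumₛ (suc K) F ≗ sumₛ K F ⊕ F (suc K)
  sumₛ-suc K F t = sym (ℤₚ.+-assoc (F 0 t) _ _)

sumₛ-split : ∀ K (F F₁ F₂ : ℕ → Series) →
             F 0 ≗ F₁ 0 → (∀ a → a < K → F (suc a) ≗ F₁ (suc a) ⊕ F₂ a) → F (suc K) ≗ F₂ K →
             sumₛ (suc K) F ≗ sumₛ K F₁ ⊕ sumₛ K F₂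
sumₛ-split K F F₁ F₂ first middle last t = begin
  F 0 t ℤ.+ (sumFrom1 K φ ℤ.+ F (suc K) t)                         ≡⟨ cong₂ (λ x y → x ℤ.+ (y ℤ.+ F (suc K) t))
                                                                         (first t) (sumFrom1-cong K middle′) ⟩
  ψ 0 ℤ.+ (sumFrom1 K (λ a → ψ a ℤ.+ χ (pred a)) ℤ.+ F (suc K) t)  ≡⟨ cong₂ (λ x y → ψ 0 ℤ.+ (x ℤ.+ y))
                                                                         (sumFrom1-+ K ψ (χ ∘ pred)) (last t) ⟩
  ψ 0 ℤ.+ ((sumFrom1 K ψ ℤ.+ sumFrom1 K (χ ∘ pred)) ℤ.+ χ K)       ≡⟨ regroup (ψ 0) _ _ _ ⟩
  sum≤ K ψ ℤ.+ (sumFrom1 K (χ ∘ pred) ℤ.+ χ K)                     ≡⟨ cong (λ x → sum≤ K ψ ℤ.+ x) (sumFrom1-pred K χ) ⟩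
  sum≤ K ψ ℤ.+ sum≤ K χ                                            ∎
  where
  open ≡-Reasoning
  φ = λ a → F a t
  ψ = λ a → F₁ a t
  χ = λ a → F₂ a t
  middle′ : ∀ a → 1 ≤ a → a ≤ K → φ a ≡ ψ a ℤ.+ χ (pred a)
  middle′ (suc a) _ a<K = middle a a<K t
  regroup : ∀ x y z w → x ℤ.+ ((y ℤ.+ z) ℤ.+ w) ≡ (x ℤ.+ y) ℤ.+ (z ℤ.+ w)
  regroup = ℤ-Solver.solve-∀

allowed? : ∀ p → Dec (Allowed p)
allowed? p = ¬? (p % 4 ≟ 2)

count : List (List ℕ) → ℕ
count = length ∘ filter (all? allowed?)

partitionSeries : ℕ → Series
partitionSeries m t = + count (partsLE m t)

count-++ : ∀ xs ys → + count (xs ++ ys) ≡ + count xs ℤ.+ + count ys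
count-++ xs ys = trans (cong (+_ ∘ length) (filter-++ (all? allowed?) xs ys))
                       (trans (cong +_ (length-++ (filter (all? allowed?) xs))) (ℤₚ.pos-+ (count xs) (count ys)))

count-concatMap : ∀ (φ : ℕ → List (List ℕ)) g n →
  + count (concatMap φ (applyUpTo g (suc n))) ≡ sum≤ n (λ j → + count (φ (g j)))
count-concatMap φ g zero    = count-++ (φ (g 0)) []
count-concatMap φ g (suc n) = begin
  + count (φ (g 0) ++ concatMap φ (applyUpTo (g ∘ suc) (suc n)))
    ≡⟨ count-++ (φ (g 0)) _ ⟩
  + count (φ (g 0)) ℤ.+ + count (concatMap φ (applyUpTo (g ∘ suc) (suc n)))
    ≡⟨ cong (λ x → + count (φ (g 0)) ℤ.+ x) (count-concatMap φ (g ∘ suc) n) ⟩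
  + count (φ (g 0)) ℤ.+ sum≤ n (λ j → + count (φ (g (suc j))))
    ≡⟨ cong (λ x → + count (φ (g 0)) ℤ.+ x) (sumFrom1-suc n (λ j → + count (φ (g j)))) ⟨
  sum≤ (suc n) (λ j → + count (φ (g j)))
    ∎
  where open ≡-Reasoning

count-map : ∀ (φ : List ℕ → List ℕ) → (∀ l → All Allowed (φ l) ⇔ All Allowed l) →
            ∀ xs → count (map φ xs) ≡ count xs
count-map φ φ⇔ []       = refl
count-map φ φ⇔ (l ∷ ls)
  with all? allowed? (φ l) | all? allowed? l | does-⇔ (φ⇔ l) (all? allowed? (φ l)) (all? allowed? l)
... | yes _ | yes _ | _ = cong suc (count-map φ φ⇔ ls)
... | no  _ | no  _ | _ = count-map φ φ⇔ ls

count-map-none : ∀ (φ : List ℕ → List ℕ) → (∀ l → ¬ All Allowed (φ l)) → ∀ xs → count (map φ xs) ≡ 0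
count-map-none φ none []       = refl
count-map-none φ none (l ∷ ls) with all? allowed? (φ l)
... | yes all = ⊥-elim (none l all)
... | no  _   = count-map-none φ none ls

block : ℕ → ℕ → ℕ → List (List ℕ)
block m n j with j ℕ.* suc m ℕ.≤? n
... | yes _ = map (replicate j (suc m) ++_) (partsLE m (n ∸ j ℕ.* suc m))
... | no  _ = []

-- The left side of partsLE-block is the where-function of partsLE, which cannot be named;
-- the type is solved from its use in partsLE-suc.
mutual
  partsLE-suc : ∀ m n → partsLE (suc m) n ≡ concatMap (block m n) (upTo (suc n))
  partsLE-suc m n = concatMap-cong (partsLE-block m n) (upTo (suc n))

  partsLE-block : ∀ m n j → _ ≡ block m n j
  partsLE-block m n j with j ℕ.* suc m ℕ.≤? n
  ... | yes _ = refl
  ... | no  _ = refl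

replicate-allowed : ∀ {k} → Allowed k → ∀ j l → All Allowed (replicate j k ++ l) ⇔ All Allowed l
replicate-allowed {k} allowed j l =
  mk⇔ (All.++⁻ʳ (replicate j k)) (All.++⁺ (All.replicate⁺ j allowed))

count-block : Allowed (suc m) → ∀ t j → + count (block m t j) ≡ (q^ (j ℕ.* suc m) · partitionSeries m) t
count-block {m} allowed t j with j ℕ.* suc m ℕ.≤? t
... | yes jk≤t = trans (cong +_ (count-map (replicate j (suc m) ++_) (replicate-allowed allowed j)
                                            (partsLE m (t ∸ j ℕ.* suc m))))
                       (sym (q^-above jk≤t))
... | no  jk≰t = sym (q^-below (ℕₚ.≰⇒> jk≰t))

count-block-forbidden : ¬ Allowed (suc m) → ∀ t j → count (block m t (suc j)) ≡ 0
count-block-forbidden {m} forbidden t j with suc j ℕ.* suc m ℕ.≤? t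
... | yes _ = count-map-none (replicate (suc j) (suc m) ++_) (λ { l (allowed ∷ _) → forbidden allowed })
                (partsLE m (t ∸ suc j ℕ.* suc m))
... | no  _ = refl

count-block-zero : ∀ m t → count (block m t 0) ≡ count (partsLE m t)
count-block-zero m t with 0 ℕ.* suc m ℕ.≤? t
... | yes _   = count-map id (λ _ → mk⇔ id id) (partsLE m t)
... | no  0≰t = ⊥-elim (0≰t z≤n)

partitionSeries-blocks : ∀ m t → partitionSeries (suc m) t ≡ sum≤ t (λ j → + count (block m t j))
partitionSeries-blocks m t = trans (cong (+_ ∘ count) (partsLE-suc m t)) (count-concatMap (block m t) id t)

partitionSeries-recurrence : Allowed (suc m) →
  partitionSeries (suc m) ≗ partitionSeries m ⊕ q^ suc m · partitionSeries (suc m)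
partitionSeries-recurrence {m} allowed t = begin
  partitionSeries (suc m) t
    ≡⟨ stable (suc t) t (ℕₚ.n≤1+n t) ⟩
  blocks (suc t) t
    ≡⟨ blocks-suc t t ⟩
  partitionSeries m t ℤ.+ (q^ k · blocks t) t
    ≡⟨ cong (λ x → partitionSeries m t ℤ.+ x)
            (q^-causal k (λ s s≤t → sym (stable t s (ℕₚ.≤-pred s≤t))) t (ℕₚ.m≤n+m (suc t) k)) ⟩
  partitionSeries m t ℤ.+ (q^ k · partitionSeries (suc m)) t
    ∎
  where
  open ≡-Reasoning
  k = suc m
  blocks : ℕ → Series
  blocks B = sumₛ B (λ j → q^ (j ℕ.* k) · partitionSeries m)
  stable : ∀ B t → t ≤ B → partitionSeries (suc m) t ≡ blocks B t
  stable B t t≤B = begin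
    partitionSeries (suc m) t             ≡⟨ partitionSeries-blocks m t ⟩
    sum≤ t (λ j → + count (block m t j))  ≡⟨ sum≤-cong t (λ j _ → count-block allowed t j) ⟩
    blocks t t                            ≡⟨ sum≤-extend t (B ∸ t) (λ j → (q^ (j ℕ.* k) · partitionSeries m) t)
                                               (λ d 1≤d _ → q^-below {f = partitionSeries m} (beyond d 1≤d)) ⟨
    blocks (t + (B ∸ t)) t                ≡⟨ cong (λ B → blocks B t) (ℕₚ.m+[n∸m]≡n t≤B) ⟩
    blocks B t                            ∎
    where
    beyond : ∀ d → 1 ≤ d → t < (t + d) ℕ.* k
    beyond d 1≤d = ℕₚ.<-≤-trans (ℕₚ.m<m+n t 1≤d) (ℕₚ.m≤m*n (t + d) k)
  blocks-suc : ∀ B → blocks (suc B) ≗ partitionSeries m ⊕ q^ k · blocks B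
  blocks-suc B t = cong (λ x → partitionSeries m t ℤ.+ x) (begin
    sumFrom1 (suc B) (λ j → (q^ (j ℕ.* k) · partitionSeries m) t)     ≡⟨ sumFrom1-suc B _ ⟩
    sum≤ B (λ j → (q^ (k + j ℕ.* k) · partitionSeries m) t)           ≡⟨ sumₛ-cong B (λ j _ → q^-+ k (j ℕ.* k) _) t ⟩
    sum≤ B (λ j → (q^ k · q^ (j ℕ.* k) · partitionSeries m) t)        ≡⟨ sumₛ-comm (q^-multiplier k) B _ t ⟨
    (q^ k · blocks B) t                                               ∎)

partitionSeries-forbidden : ¬ Allowed (suc m) → partitionSeries (suc m) ≗ partitionSeries m
partitionSeries-forbidden {m} forbidden t = begin
  partitionSeries (suc m) t
    ≡⟨ partitionSeries-blocks m t ⟩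
  + count (block m t 0) ℤ.+ sumFrom1 t (λ j → + count (block m t j))
    ≡⟨ cong₂ ℤ._+_ (cong +_ (count-block-zero m t)) (sumFrom1-zero t none) ⟩
  partitionSeries m t ℤ.+ 0ℤ
    ≡⟨ ℤₚ.+-identityʳ _ ⟩
  partitionSeries m t
    ∎
  where
  open ≡-Reasoning
  none : ∀ j → 1 ≤ j → j ≤ t → + count (block m t j) ≡ 0ℤ
  none (suc j) _ _ = cong +_ (count-block-forbidden forbidden t j)

factor : ℕ → Series → Series
factor k f with allowed? k
... | yes _ = 1-q^ k · f
... | no  _ = f

factor-partitionSeries : ∀ m → factor (suc m) (partitionSeries (suc m)) ≗ partitionSeries m
factor-partitionSeries m t with allowed? (suc m)
... | yes allowed = begin
  P′ t ℤ.+ -1ℤ * (q^ suc m · P′) t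
    ≡⟨ cong (λ x → x ℤ.+ -1ℤ * (q^ suc m · P′) t) (partitionSeries-recurrence allowed t) ⟩
  (partitionSeries m t ℤ.+ (q^ suc m · P′) t) ℤ.+ -1ℤ * (q^ suc m · P′) t
    ≡⟨ cancel (partitionSeries m t) ((q^ suc m · P′) t) ⟩
  partitionSeries m t
    ∎
  where
  open ≡-Reasoning
  P′ = partitionSeries (suc m)
  cancel : ∀ x y → (x ℤ.+ y) ℤ.+ - + 1 * y ≡ x
  cancel = ℤ-Solver.solve-∀
... | no forbidden = partitionSeries-forbidden {m} forbidden t

partitionSeries-stable : t ≤ m → partitionSeries (suc m) t ≡ partitionSeries m t
partitionSeries-stable {t} {m} t≤m with allowed? (suc m)
... | yes allowed = begin
  partitionSeries (suc m) t
    ≡⟨ partitionSeries-recurrence allowed t ⟩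
  partitionSeries m t ℤ.+ (q^ suc m · partitionSeries (suc m)) t
    ≡⟨ cong (λ x → partitionSeries m t ℤ.+ x) (q^-below (s≤s t≤m)) ⟩
  partitionSeries m t ℤ.+ 0ℤ
    ≡⟨ ℤₚ.+-identityʳ _ ⟩
  partitionSeries m t
    ∎
  where open ≡-Reasoning
... | no forbidden = partitionSeries-forbidden {m} forbidden t

partitionSeries-C4 : t ≤ M → partitionSeries M t ≡ + C4 t
partitionSeries-C4 {t} {M} t≤M = trans (cong (λ M → partitionSeries M t) (sym (ℕₚ.m∸n+n≡m t≤M))) (stable (M ∸ t))
  where
  stable : ∀ e → partitionSeries (e + t) t ≡ + C4 t
  stable zero    = refl
  stable (suc e) = trans (partitionSeries-stable (ℕₚ.m≤n+m t e)) (stable e)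

factor-multiplier : ∀ k → Multiplier (factor k)
factor-multiplier k with allowed? k
... | yes _ = 1-q^-multiplier k
... | no  _ = id-multiplier

factor-injective : ∀ m → factor (suc m) f ≗[< M ] factor (suc m) g → f ≗[< M ] g
factor-injective m with allowed? (suc m)
... | yes _ = 1-q^-injective
... | no  _ = id

factor-allowed : ∀ k → Allowed k → ∀ f → factor k f ≗ 1-q^ k · f
factor-allowed k allowed f with allowed? k
... | yes _         = ≗-refl
... | no  forbidden = ⊥-elim (forbidden allowed)

factor-forbidden : ∀ k → ¬ Allowed k → ∀ f → factor k f ≗ f
factor-forbidden k forbidden f with allowed? k
... | yes allowed = ⊥-elim (forbidden allowed)
... | no  _       = ≗-refl

factor-comm : ∀ {O} → Multiplier O → ∀ k f → O (factor k f) ≗ factor k (O f)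
factor-comm μ k f with allowed? k
... | yes _ = 1-q^-comm μ k f
... | no  _ = ≗-refl

allowedProduct : ℕ → Series → Series
allowedProduct zero    f = f
allowedProduct (suc M) f = factor (suc M) (allowedProduct M f)

allowedProduct-multiplier : ∀ M → Multiplier (allowedProduct M)
allowedProduct-multiplier zero    = id-multiplier
allowedProduct-multiplier (suc M) = ∘-multiplier (factor-multiplier (suc M)) (allowedProduct-multiplier M)

allowedProduct-injective : ∀ M → allowedProduct M f ≗[< N ] allowedProduct M g → f ≗[< N ] g
allowedProduct-injective zero    = id
allowedProduct-injective (suc M) = allowedProduct-injective M ∘ factor-injective M

allowedProduct-partitionSeries : ∀ M → allowedProduct M (partitionSeries M) ≗ one
allowedProduct-partitionSeries zero    zero    = refl
allowedProduct-partitionSeries zero    (suc t) = refl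
allowedProduct-partitionSeries (suc M) = begin
  factor (suc M) (allowedProduct M (partitionSeries (suc M)))
    ≈⟨ factor-comm (allowedProduct-multiplier M) (suc M) _ ⟨
  allowedProduct M (factor (suc M) (partitionSeries (suc M)))
    ≈⟨ ≗-cong (allowedProduct-multiplier M) (factor-partitionSeries M) ⟩
  allowedProduct M (partitionSeries M)
    ≈⟨ allowedProduct-partitionSeries M ⟩
  one
    ∎
  where open ≗-Reasoning

-- Gaussian binomial coefficients in q⁴

-- gauss a b is the Gaussian binomial [a+b, a] evaluated at q⁴.
gauss : ℕ → ℕ → Series
gauss zero    b       = one
gauss (suc a) zero    = one
gauss (suc a) (suc b) = gauss a (suc b) ⊕ q^ (4 ℕ.* suc a) · gauss (suc a) b

gauss-zeroʳ : ∀ a → gauss a 0 ≗ one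
gauss-zeroʳ zero    = ≗-refl
gauss-zeroʳ (suc a) = ≗-refl

gauss-pascal′ : ∀ a b → gauss (suc a) (suc b) ≗ gauss (suc a) b ⊕ q^ (4 ℕ.* suc b) · gauss a (suc b)
gauss-pascal′ zero    zero    = ≗-refl
gauss-pascal′ zero    (suc b) = begin
  one ⊕ q^ 4 · gauss 1 (suc b)
    ≈⟨ ⊕-congˡ one (q^-cong 4 (gauss-pascal′ zero b)) ⟩
  one ⊕ q^ 4 · (gauss 1 b ⊕ q^ (4 ℕ.* suc b) · one)
    ≈⟨ ⊕-congˡ one (q^-⊕ 4 _ _) ⟩
  one ⊕ (q^ 4 · gauss 1 b ⊕ q^ 4 · q^ (4 ℕ.* suc b) · one)
    ≈⟨ ⊕-assoc one _ _ ⟨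
  gauss 1 (suc b) ⊕ q^ 4 · q^ (4 ℕ.* suc b) · one
    ≈⟨ ⊕-congˡ (gauss 1 (suc b)) (≗-trans (≗-sym (q^-+ 4 (4 ℕ.* suc b) one)) (q^-≡ one (sym (ℕₚ.*-suc 4 (suc b))))) ⟩
  gauss 1 (suc b) ⊕ q^ (4 ℕ.* suc (suc b)) · one
    ∎
  where open ≗-Reasoning
gauss-pascal′ (suc a) zero    = begin
  gauss (suc a) 1 ⊕ q^ (4 ℕ.* suc (suc a)) · one
    ≈⟨ ⊕-congʳ (q^ (4 ℕ.* suc (suc a)) · one) (gauss-pascal′ a zero) ⟩
  (one ⊕ q^ 4 · gauss a 1) ⊕ q^ (4 ℕ.* suc (suc a)) · one
    ≈⟨ ⊕-assoc one _ _ ⟩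
  one ⊕ (q^ 4 · gauss a 1 ⊕ q^ (4 ℕ.* suc (suc a)) · one)
    ≈⟨ ⊕-congˡ one (⊕-congˡ (q^ 4 · gauss a 1) (≗-trans (q^-≡ one (ℕₚ.*-suc 4 (suc a))) (q^-+ 4 (4 ℕ.* suc a) one))) ⟩
  one ⊕ (q^ 4 · gauss a 1 ⊕ q^ 4 · q^ (4 ℕ.* suc a) · one)
    ≈⟨ ⊕-congˡ one (q^-⊕ 4 _ _) ⟨
  one ⊕ q^ 4 · gauss (suc a) 1
    ∎
  where open ≗-Reasoning
gauss-pascal′ (suc a) (suc b) = begin
  gauss (suc a) (suc (suc b)) ⊕ q^ A · gauss (suc (suc a)) (suc b)
    ≈⟨ ⊕-cong (gauss-pascal′ a (suc b)) (q^-cong A (gauss-pascal′ (suc a) b)) ⟩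
  (x ⊕ q^ B · gauss a (suc (suc b))) ⊕ q^ A · (gauss (suc (suc a)) b ⊕ q^ (4 ℕ.* suc b) · x)
    ≈⟨ ⊕-congˡ (x ⊕ q^ B · gauss a (suc (suc b)))
         (≗-trans (q^-⊕ A (gauss (suc (suc a)) b) (q^ (4 ℕ.* suc b) · x))
                  (⊕-congˡ (q^ A · gauss (suc (suc a)) b) (≗-sym (q^-+ A (4 ℕ.* suc b) x)))) ⟩
  (x ⊕ q^ B · gauss a (suc (suc b))) ⊕ (q^ A · gauss (suc (suc a)) b ⊕ q^ (A + 4 ℕ.* suc b) · x)
    ≈⟨ ⊕-interchange x (q^ B · gauss a (suc (suc b))) (q^ A · gauss (suc (suc a)) b) (q^ (A + 4 ℕ.* suc b) · x) ⟩
  (x ⊕ q^ A · gauss (suc (suc a)) b) ⊕ (q^ B · gauss a (suc (suc b)) ⊕ q^ (A + 4 ℕ.* suc b) · x)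
    ≈⟨ ⊕-congˡ (x ⊕ q^ A · gauss (suc (suc a)) b) (⊕-congˡ (q^ B · gauss a (suc (suc b)))
         (≗-trans (q^-≡ x (exponents a b)) (q^-+ B (4 ℕ.* suc a) x))) ⟩
  gauss (suc (suc a)) (suc b) ⊕ (q^ B · gauss a (suc (suc b)) ⊕ q^ B · q^ (4 ℕ.* suc a) · x)
    ≈⟨ ⊕-congˡ (gauss (suc (suc a)) (suc b)) (q^-⊕ B (gauss a (suc (suc b))) (q^ (4 ℕ.* suc a) · x)) ⟨
  gauss (suc (suc a)) (suc b) ⊕ q^ B · gauss (suc a) (suc (suc b))
    ∎
  where
  open ≗-Reasoning
  A = 4 ℕ.* suc (suc a)
  B = 4 ℕ.* suc (suc b)
  x = gauss (suc a) (suc b)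
  exponents : ∀ a b → 4 ℕ.* suc (suc a) + 4 ℕ.* suc b ≡ 4 ℕ.* suc (suc b) + 4 ℕ.* suc a
  exponents = ℕ-Solver.solve-∀

gauss-sym : ∀ a b → gauss a b ≗ gauss b a
gauss-sym zero    zero    = ≗-refl
gauss-sym zero    (suc b) = ≗-refl
gauss-sym (suc a) zero    = ≗-refl
gauss-sym (suc a) (suc b) = ≗-trans (⊕-cong (gauss-sym a (suc b)) (q^-cong (4 ℕ.* suc a) (gauss-sym (suc a) b)))
                                    (≗-sym (gauss-pascal′ b a))

gauss-ratio : ∀ a b → 1-q^ (4 ℕ.* suc b) · gauss a (suc b) ≗ 1-q^ (4 ℕ.* (a + suc b)) · gauss a b
gauss-ratio zero    b = ≗-refl
gauss-ratio (suc a) b = begin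
  (u ⊕ v) ⊕ -1ℤ ⊙ q^ B · (u ⊕ v)
    ≈⟨ ⊕-congʳ (-1ℤ ⊙ q^ B · (u ⊕ v)) (gauss-pascal′ a b) ⟩
  (y ⊕ q^ B · u) ⊕ -1ℤ ⊙ q^ B · (u ⊕ v)
    ≈⟨ ⊕-congˡ (y ⊕ q^ B · u) (⊙-cong -1ℤ (q^-⊕ B u v)) ⟩
  (y ⊕ q^ B · u) ⊕ -1ℤ ⊙ (q^ B · u ⊕ q^ B · v)
    ≈⟨ (λ t → cancel (y t) ((q^ B · u) t) ((q^ B · v) t)) ⟩
  y ⊕ -1ℤ ⊙ q^ B · v
    ≈⟨ ⊕-congˡ y (⊙-cong -1ℤ (≗-trans (≗-sym (q^-+ B (4 ℕ.* suc a) y)) (q^-≡ y (exponents a b)))) ⟩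
  y ⊕ -1ℤ ⊙ q^ (4 ℕ.* (suc a + suc b)) · y
    ∎
  where
  open ≗-Reasoning
  B = 4 ℕ.* suc b
  u = gauss a (suc b)
  v = q^ (4 ℕ.* suc a) · gauss (suc a) b
  y = gauss (suc a) b
  cancel : ∀ y w z → (y ℤ.+ w) ℤ.+ - + 1 * (w ℤ.+ z) ≡ y ℤ.+ - + 1 * z
  cancel = ℤ-Solver.solve-∀
  exponents : ∀ a b → 4 ℕ.* suc b + 4 ℕ.* suc a ≡ 4 ℕ.* (suc a + suc b)
  exponents = ℕ-Solver.solve-∀

∏ : (ℕ → ℕ) → ℕ → Series → Series
∏ e zero    f = f
∏ e (suc n) f = 1-q^ e n · ∏ e n f

∏-multiplier : ∀ e n → Multiplier (∏ e n)
∏-multiplier e zero    = id-multiplier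
∏-multiplier e (suc n) = ∘-multiplier (1-q^-multiplier (e n)) (∏-multiplier e n)

∏₄ ∏₃ ∏₁ : ℕ → Series → Series
∏₄ = ∏ (λ j → 4 ℕ.* suc j)
∏₃ = ∏ (λ j → 3 + 4 ℕ.* j)
∏₁ = ∏ (λ j → 1 + 4 ℕ.* j)

∏₄-truncate : ∀ {b} → b ≤ N → ∀ f → ∏₄ N f ≗[< 4 ℕ.* suc b ] ∏₄ b f
∏₄-truncate {N} {b} b≤N f = subst (λ N → ∏₄ N f ≗[< 4 ℕ.* suc b ] ∏₄ b f) (ℕₚ.m∸n+n≡m b≤N) (above (N ∸ b))
  where
  above : ∀ e → ∏₄ (e + b) f ≗[< 4 ℕ.* suc b ] ∏₄ b f
  above zero    = ≗⇒≗[<] ≗-refl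
  above (suc e) = ≗[<]-trans (≗[<]-weaken (ℕₚ.*-monoʳ-≤ 4 (s≤s (ℕₚ.m≤n+m b e))) (1-q^-below _ (∏₄ (e + b) f)))
                             (above e)

-- (q⁴;q⁴)_b [a+b, a]_{q⁴} = (q^{4(a+1)};q⁴)_b
∏₄-gauss-exact : ∀ a b → ∏₄ b (gauss a b) ≗[< 4 ℕ.* suc a ] one
∏₄-gauss-exact a zero    = ≗⇒≗[<] (gauss-zeroʳ a)
∏₄-gauss-exact a (suc b) =
  ≗[<]-trans (≗⇒≗[<] (≗-sym (1-q^-comm (∏-multiplier _ b) (4 ℕ.* suc b) (gauss a (suc b)))))
 (≗[<]-trans (≗⇒≗[<] (≗-cong (∏-multiplier _ b) (gauss-ratio a b)))
 (≗[<]-trans (causal (∏-multiplier _ b)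
                (≗[<]-weaken (ℕₚ.*-monoʳ-≤ 4 suc-a≤a+suc-b) (1-q^-below _ (gauss a b))))
             (∏₄-gauss-exact a b)))
  where
  suc-a≤a+suc-b : suc a ≤ a + suc b
  suc-a≤a+suc-b = ℕₚ.≤-trans (s≤s (ℕₚ.m≤m+n a b)) (ℕₚ.≤-reflexive (sym (ℕₚ.+-suc a b)))

∏₄-gauss : ∀ {a b M} → b ≤ N → M ≤ 4 ℕ.* suc a → M ≤ 4 ℕ.* suc b → ∏₄ N (gauss a b) ≗[< M ] one
∏₄-gauss {a = a} {b} b≤N M≤a M≤b =
  ≗[<]-trans (≗[<]-weaken M≤b (∏₄-truncate b≤N (gauss a b))) (≗[<]-weaken M≤a (∏₄-gauss-exact a b))

-- A finite form of Jacobi's triple product identity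

sqDist : ℕ → ℕ → ℕ
sqDist a n = ∣ a - n ∣ ℕ.* ∣ a - n ∣

-- (a + 1 - n)² = (a - n)² + 2(a - n) + 1, with 2n moved to the left
sqDist-sucˡ : ∀ a n → sqDist (suc a) n + 2 ℕ.* n ≡ 1 + 2 ℕ.* a + sqDist a n
sqDist-sucˡ zero    zero    = refl
sqDist-sucˡ (suc a) zero    = square a
  where
  square : ∀ a → suc (suc a) ℕ.* suc (suc a) + 2 ℕ.* 0 ≡ 1 + 2 ℕ.* suc a + suc a ℕ.* suc a
  square = ℕ-Solver.solve-∀
sqDist-sucˡ zero    (suc n) = square n
  where
  square : ∀ n → n ℕ.* n + 2 ℕ.* suc n ≡ 1 + 2 ℕ.* 0 + suc n ℕ.* suc n
  square = ℕ-Solver.solve-∀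
sqDist-sucˡ (suc a) (suc n) = begin
  sqDist (suc a) n + 2 ℕ.* suc n       ≡⟨ shuffle (sqDist (suc a) n) n ⟩
  (sqDist (suc a) n + 2 ℕ.* n) + 2     ≡⟨ cong (_+ 2) (sqDist-sucˡ a n) ⟩
  (1 + 2 ℕ.* a + sqDist a n) + 2       ≡⟨ shuffle′ a (sqDist a n) ⟩
  1 + 2 ℕ.* suc a + sqDist a n         ∎
  where
  open ≡-Reasoning
  shuffle : ∀ s n → s + 2 ℕ.* suc n ≡ (s + 2 ℕ.* n) + 2
  shuffle = ℕ-Solver.solve-∀
  shuffle′ : ∀ a s → (1 + 2 ℕ.* a + s) + 2 ≡ 1 + 2 ℕ.* suc a + s
  shuffle′ = ℕ-Solver.solve-∀

jacobiExp : ℕ → ℕ → ℕ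
jacobiExp a n = a + 2 ℕ.* sqDist a n

jacobiExp-sucˡ : ∀ a c m n → a + c ≡ m + n → jacobiExp (suc a) n + 4 ℕ.* c ≡ (3 + 4 ℕ.* m) + jacobiExp a n
jacobiExp-sucˡ a c m n a+c≡m+n = ℕₚ.+-cancelʳ-≡ (4 ℕ.* n) _ _ (begin
  (suc a + 2 ℕ.* sqDist (suc a) n + 4 ℕ.* c) + 4 ℕ.* n   ≡⟨ regroup a c n (sqDist (suc a) n) ⟩
  suc a + 2 ℕ.* (sqDist (suc a) n + 2 ℕ.* n) + 4 ℕ.* c   ≡⟨ cong (λ s → suc a + 2 ℕ.* s + 4 ℕ.* c) (sqDist-sucˡ a n) ⟩
  suc a + 2 ℕ.* (1 + 2 ℕ.* a + sqDist a n) + 4 ℕ.* c     ≡⟨ regroup′ a c (sqDist a n) ⟩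
  3 + a + 2 ℕ.* sqDist a n + 4 ℕ.* (a + c)               ≡⟨ cong (λ x → 3 + a + 2 ℕ.* sqDist a n + 4 ℕ.* x) a+c≡m+n ⟩
  3 + a + 2 ℕ.* sqDist a n + 4 ℕ.* (m + n)               ≡⟨ regroup″ a m n (sqDist a n) ⟩
  ((3 + 4 ℕ.* m) + jacobiExp a n) + 4 ℕ.* n              ∎)
  where
  open ≡-Reasoning
  regroup : ∀ a c n s → (suc a + 2 ℕ.* s + 4 ℕ.* c) + 4 ℕ.* n ≡ suc a + 2 ℕ.* (s + 2 ℕ.* n) + 4 ℕ.* c
  regroup = ℕ-Solver.solve-∀
  regroup′ : ∀ a c s → suc a + 2 ℕ.* (1 + 2 ℕ.* a + s) + 4 ℕ.* c ≡ 3 + a + 2 ℕ.* s + 4 ℕ.* (a + c)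
  regroup′ = ℕ-Solver.solve-∀
  regroup″ : ∀ a m n s → 3 + a + 2 ℕ.* s + 4 ℕ.* (m + n) ≡ ((3 + 4 ℕ.* m) + (a + 2 ℕ.* s)) + 4 ℕ.* n
  regroup″ = ℕ-Solver.solve-∀

jacobiExp-sucʳ : ∀ a n → jacobiExp a (suc n) + 4 ℕ.* a ≡ (2 + 4 ℕ.* n) + jacobiExp a n
jacobiExp-sucʳ a n = begin
  a + 2 ℕ.* sqDist a (suc n) + 4 ℕ.* a       ≡⟨ cong (λ s → a + 2 ℕ.* s + 4 ℕ.* a) (sqDist-comm a (suc n)) ⟩
  a + 2 ℕ.* sqDist (suc n) a + 4 ℕ.* a       ≡⟨ regroup a (sqDist (suc n) a) ⟩
  a + 2 ℕ.* (sqDist (suc n) a + 2 ℕ.* a)     ≡⟨ cong (λ s → a + 2 ℕ.* s) (sqDist-sucˡ n a) ⟩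
  a + 2 ℕ.* (1 + 2 ℕ.* n + sqDist n a)       ≡⟨ cong (λ s → a + 2 ℕ.* (1 + 2 ℕ.* n + s)) (sqDist-comm n a) ⟩
  a + 2 ℕ.* (1 + 2 ℕ.* n + sqDist a n)       ≡⟨ regroup′ a n (sqDist a n) ⟩
  (2 + 4 ℕ.* n) + jacobiExp a n              ∎
  where
  open ≡-Reasoning
  sqDist-comm : ∀ a n → sqDist a n ≡ sqDist n a
  sqDist-comm a n = cong (λ d → d ℕ.* d) (ℕₚ.∣-∣-comm a n)
  regroup : ∀ a s → a + 2 ℕ.* s + 4 ℕ.* a ≡ a + 2 ℕ.* (s + 2 ℕ.* a)
  regroup = ℕ-Solver.solve-∀
  regroup′ : ∀ a n s → a + 2 ℕ.* (1 + 2 ℕ.* n + s) ≡ (2 + 4 ℕ.* n) + (a + 2 ℕ.* s)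
  regroup′ = ℕ-Solver.solve-∀

jacobiTerm : ℕ → ℕ → ℕ → Series
jacobiTerm m n a = (-1ℤ ^ a) ⊙ q^ jacobiExp a n · gauss a (m + n ∸ a)

jacobiSum : ℕ → ℕ → Series
jacobiSum m n = sumₛ (m + n) (jacobiTerm m n)

∸-suc : ∀ {a K} → a < K → K ∸ a ≡ suc (K ∸ suc a)
∸-suc {a} a<K = ℕₚ.+-∸-assoc 1 a<K

+-suc-∸ : ∀ {a K} → a < K → a + suc (K ∸ suc a) ≡ K
+-suc-∸ {a} a<K = trans (ℕₚ.+-suc a _) (ℕₚ.m+[n∸m]≡n a<K)

jacobiTerm-shiftˡ : ∀ m n a c → a + c ≡ m + n →
  (-1ℤ ^ suc a) ⊙ q^ jacobiExp (suc a) n · q^ (4 ℕ.* c) · gauss a c ≗ -1ℤ ⊙ q^ (3 + 4 ℕ.* m) · jacobiTerm m n a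
jacobiTerm-shiftˡ m n a c a+c≡m+n = begin
  (-1ℤ ^ suc a) ⊙ q^ jacobiExp (suc a) n · q^ (4 ℕ.* c) · gauss a c
    ≈⟨ ⊙-cong (-1ℤ ^ suc a) (≗-sym (q^-+ (jacobiExp (suc a) n) (4 ℕ.* c) (gauss a c))) ⟩
  (-1ℤ ^ suc a) ⊙ q^ (jacobiExp (suc a) n + 4 ℕ.* c) · gauss a c
    ≡⟨ cong₂ (λ e b → (-1ℤ ^ suc a) ⊙ q^ e · gauss a b) (jacobiExp-sucˡ a c m n a+c≡m+n) c≡m+n∸a ⟩
  (-1ℤ ^ suc a) ⊙ q^ ((3 + 4 ℕ.* m) + jacobiExp a n) · gauss a (m + n ∸ a)
    ≈⟨ ⊙q^-⊙q^ -1ℤ (3 + 4 ℕ.* m) (-1ℤ ^ a) (jacobiExp a n) _ ⟨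
  -1ℤ ⊙ q^ (3 + 4 ℕ.* m) · jacobiTerm m n a
    ∎
  where
  open ≗-Reasoning
  c≡m+n∸a : c ≡ m + n ∸ a
  c≡m+n∸a = trans (sym (ℕₚ.m+n∸m≡n a c)) (cong (_∸ a) a+c≡m+n)

jacobiTerm-sucˡ : ∀ m n a → a < m + n →
  jacobiTerm (suc m) n (suc a) ≗ jacobiTerm m n (suc a) ⊕ -1ℤ ⊙ q^ (3 + 4 ℕ.* m) · jacobiTerm m n a
jacobiTerm-sucˡ m n a a<K = begin
  (-1ℤ ^ suc a) ⊙ q^ E · gauss (suc a) (m + n ∸ a)
    ≡⟨ cong (λ b → (-1ℤ ^ suc a) ⊙ q^ E · gauss (suc a) b) (∸-suc a<K) ⟩
  (-1ℤ ^ suc a) ⊙ q^ E · gauss (suc a) (suc b)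
    ≈⟨ ≗-cong μ (gauss-pascal′ a b) ⟩
  (-1ℤ ^ suc a) ⊙ q^ E · (gauss (suc a) b ⊕ q^ (4 ℕ.* suc b) · gauss a (suc b))
    ≈⟨ ⊕-homo μ (gauss (suc a) b) (q^ (4 ℕ.* suc b) · gauss a (suc b)) ⟩
  jacobiTerm m n (suc a) ⊕ (-1ℤ ^ suc a) ⊙ q^ E · q^ (4 ℕ.* suc b) · gauss a (suc b)
    ≈⟨ ⊕-congˡ (jacobiTerm m n (suc a)) (jacobiTerm-shiftˡ m n a (suc b) (+-suc-∸ a<K)) ⟩
  jacobiTerm m n (suc a) ⊕ -1ℤ ⊙ q^ (3 + 4 ℕ.* m) · jacobiTerm m n a
    ∎
  where
  open ≗-Reasoning
  E = jacobiExp (suc a) n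
  b = m + n ∸ suc a
  μ = monomial-multiplier (-1ℤ ^ suc a) E

jacobiTerm-sucˡ-last : ∀ m n → jacobiTerm (suc m) n (suc (m + n)) ≗ -1ℤ ⊙ q^ (3 + 4 ℕ.* m) · jacobiTerm m n (m + n)
jacobiTerm-sucˡ-last m n = begin
  (-1ℤ ^ suc K) ⊙ q^ E · gauss (suc K) (K ∸ K)
    ≡⟨ cong (λ b → (-1ℤ ^ suc K) ⊙ q^ E · gauss (suc K) b) (ℕₚ.n∸n≡0 K) ⟩
  (-1ℤ ^ suc K) ⊙ q^ E · gauss (suc K) 0
    ≈⟨ ≗-cong (monomial-multiplier (-1ℤ ^ suc K) E) (≗-sym (gauss-zeroʳ K)) ⟩
  (-1ℤ ^ suc K) ⊙ q^ E · q^ 0 · gauss K 0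
    ≈⟨ jacobiTerm-shiftˡ m n K 0 (ℕₚ.+-identityʳ K) ⟩
  -1ℤ ⊙ q^ (3 + 4 ℕ.* m) · jacobiTerm m n K
    ∎
  where
  open ≗-Reasoning
  K = m + n
  E = jacobiExp (suc K) n

jacobiSum-sucˡ : ∀ m n → jacobiSum (suc m) n ≗ 1-q^ (3 + 4 ℕ.* m) · jacobiSum m n
jacobiSum-sucˡ m n = begin
  sumₛ (suc K) (jacobiTerm (suc m) n)
    ≈⟨ sumₛ-split K (jacobiTerm (suc m) n) (jacobiTerm m n) (λ a → -1ℤ ⊙ q^ e · jacobiTerm m n a)
                  (λ _ → refl) (jacobiTerm-sucˡ m n) (jacobiTerm-sucˡ-last m n) ⟩
  jacobiSum m n ⊕ sumₛ K (λ a → -1ℤ ⊙ q^ e · jacobiTerm m n a)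
    ≈⟨ ⊕-congˡ (jacobiSum m n) (≗-sym (sumₛ-comm (monomial-multiplier -1ℤ e) K (jacobiTerm m n))) ⟩
  1-q^ e · jacobiSum m n
    ∎
  where
  open ≗-Reasoning
  K = m + n
  e = 3 + 4 ℕ.* m

jacobiTerm-shiftʳ : ∀ m n a →
  (-1ℤ ^ a) ⊙ q^ jacobiExp a (suc n) · q^ (4 ℕ.* a) · gauss a (m + n ∸ a) ≗ q^ (2 + 4 ℕ.* n) · jacobiTerm m n a
jacobiTerm-shiftʳ m n a = begin
  (-1ℤ ^ a) ⊙ q^ jacobiExp a (suc n) · q^ (4 ℕ.* a) · gauss a (m + n ∸ a)
    ≈⟨ ⊙-cong (-1ℤ ^ a) (≗-sym (q^-+ (jacobiExp a (suc n)) (4 ℕ.* a) _)) ⟩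
  (-1ℤ ^ a) ⊙ q^ (jacobiExp a (suc n) + 4 ℕ.* a) · gauss a (m + n ∸ a)
    ≡⟨ cong (λ e → (-1ℤ ^ a) ⊙ q^ e · gauss a (m + n ∸ a)) (jacobiExp-sucʳ a n) ⟩
  (-1ℤ ^ a) ⊙ q^ ((2 + 4 ℕ.* n) + jacobiExp a n) · gauss a (m + n ∸ a)
    ≈⟨ q^-⊙q^ (2 + 4 ℕ.* n) (-1ℤ ^ a) (jacobiExp a n) _ ⟨
  q^ (2 + 4 ℕ.* n) · jacobiTerm m n a
    ∎
  where open ≗-Reasoning

m+suc-n∸ : ∀ m n a → m + suc n ∸ suc a ≡ m + n ∸ a
m+suc-n∸ m n a = cong (_∸ suc a) (ℕₚ.+-suc m n)

jacobiTerm-sucʳ : ∀ m n a → a < m + n →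
  jacobiTerm m (suc n) (suc a) ≗ q^ (2 + 4 ℕ.* n) · jacobiTerm m n (suc a) ⊕ -1ℤ ⊙ q^ 1 · jacobiTerm m n a
jacobiTerm-sucʳ m n a a<K = begin
  (-1ℤ ^ suc a) ⊙ q^ E · gauss (suc a) (m + suc n ∸ suc a)
    ≡⟨ cong (λ b → (-1ℤ ^ suc a) ⊙ q^ E · gauss (suc a) b) (trans (m+suc-n∸ m n a) (∸-suc a<K)) ⟩
  (-1ℤ ^ suc a) ⊙ q^ E · (gauss a (suc b) ⊕ q^ (4 ℕ.* suc a) · gauss (suc a) b)
    ≈⟨ ⊕-homo (monomial-multiplier (-1ℤ ^ suc a) E) (gauss a (suc b)) (q^ (4 ℕ.* suc a) · gauss (suc a) b) ⟩
  (-1ℤ ^ suc a) ⊙ q^ E · gauss a (suc b) ⊕ shifted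
    ≡⟨ cong (λ b → (-1ℤ ^ suc a) ⊙ q^ E · gauss a b ⊕ shifted) (sym (∸-suc a<K)) ⟩
  (-1ℤ ^ suc a) ⊙ q^ (1 + jacobiExp a n) · gauss a (m + n ∸ a) ⊕ shifted
    ≈⟨ ⊕-cong (≗-sym (⊙q^-⊙q^ -1ℤ 1 (-1ℤ ^ a) (jacobiExp a n) _)) (jacobiTerm-shiftʳ m n (suc a)) ⟩
  -1ℤ ⊙ q^ 1 · jacobiTerm m n a ⊕ q^ (2 + 4 ℕ.* n) · jacobiTerm m n (suc a)
    ≈⟨ ⊕-comm (-1ℤ ⊙ q^ 1 · jacobiTerm m n a) (q^ (2 + 4 ℕ.* n) · jacobiTerm m n (suc a)) ⟩
  q^ (2 + 4 ℕ.* n) · jacobiTerm m n (suc a) ⊕ -1ℤ ⊙ q^ 1 · jacobiTerm m n a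
    ∎
  where
  open ≗-Reasoning
  E = jacobiExp (suc a) (suc n)
  b = m + n ∸ suc a
  shifted = (-1ℤ ^ suc a) ⊙ q^ E · q^ (4 ℕ.* suc a) · gauss (suc a) b

jacobiTerm-sucʳ-last : ∀ m n → jacobiTerm m (suc n) (suc (m + n)) ≗ -1ℤ ⊙ q^ 1 · jacobiTerm m n (m + n)
jacobiTerm-sucʳ-last m n = begin
  (-1ℤ ^ suc K) ⊙ q^ (1 + jacobiExp K n) · gauss (suc K) (m + suc n ∸ suc K)
    ≈⟨ ≗-cong (monomial-multiplier (-1ℤ ^ suc K) (1 + jacobiExp K n)) top ⟩
  (-1ℤ ^ suc K) ⊙ q^ (1 + jacobiExp K n) · gauss K (K ∸ K)
    ≈⟨ ⊙q^-⊙q^ -1ℤ 1 (-1ℤ ^ K) (jacobiExp K n) _ ⟨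
  -1ℤ ⊙ q^ 1 · jacobiTerm m n K
    ∎
  where
  open ≗-Reasoning
  K = m + n
  top : gauss (suc K) (m + suc n ∸ suc K) ≗ gauss K (K ∸ K)
  top t = trans (cong (λ b → gauss (suc K) b t) (trans (m+suc-n∸ m n K) (ℕₚ.n∸n≡0 K)))
                (trans (sym (gauss-zeroʳ K t)) (cong (λ b → gauss K b t) (sym (ℕₚ.n∸n≡0 K))))

jacobiSum-sucʳ : ∀ m n → jacobiSum m (suc n) ≗ -1ℤ ⊙ q^ 1 · 1-q^ (1 + 4 ℕ.* n) · jacobiSum m n
jacobiSum-sucʳ m n = begin
  sumₛ (m + suc n) (jacobiTerm m (suc n))
    ≡⟨ cong (λ K → sumₛ K (jacobiTerm m (suc n))) (ℕₚ.+-suc m n) ⟩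
  sumₛ (suc K) (jacobiTerm m (suc n))
    ≈⟨ sumₛ-split K (jacobiTerm m (suc n)) (λ a → q^ e · jacobiTerm m n a) (λ a → -1ℤ ⊙ q^ 1 · jacobiTerm m n a)
                  (jacobiTerm-shiftʳ m n 0) (jacobiTerm-sucʳ m n) (jacobiTerm-sucʳ-last m n) ⟩
  sumₛ K (λ a → q^ e · jacobiTerm m n a) ⊕ sumₛ K (λ a → -1ℤ ⊙ q^ 1 · jacobiTerm m n a)
    ≈⟨ ⊕-cong (≗-sym (sumₛ-comm (q^-multiplier e) K (jacobiTerm m n)))
              (≗-sym (sumₛ-comm (monomial-multiplier -1ℤ 1) K (jacobiTerm m n))) ⟩
  q^ e · Θ ⊕ -1ℤ ⊙ q^ 1 · Θ
    ≈⟨ ⊕-comm (q^ e · Θ) (-1ℤ ⊙ q^ 1 · Θ) ⟩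
  -1ℤ ⊙ q^ 1 · Θ ⊕ q^ e · Θ
    ≈⟨ ⊕-congˡ (-1ℤ ⊙ q^ 1 · Θ) (≗-trans (≗-sym (⊙-identityˡ (q^ e · Θ)))
                                        (≗-sym (⊙q^-⊙q^ -1ℤ 1 -1ℤ (1 + 4 ℕ.* n) Θ))) ⟩
  -1ℤ ⊙ q^ 1 · Θ ⊕ -1ℤ ⊙ q^ 1 · -1ℤ ⊙ q^ (1 + 4 ℕ.* n) · Θ
    ≈⟨ ⊕-homo (monomial-multiplier -1ℤ 1) Θ _ ⟨
  -1ℤ ⊙ q^ 1 · 1-q^ (1 + 4 ℕ.* n) · Θ
    ∎
  where
  open ≗-Reasoning
  K = m + n
  e = 2 + 4 ℕ.* n
  Θ = jacobiSum m n

jacobiSum-closed : ∀ m n → jacobiSum m n ≗ (-1ℤ ^ n) ⊙ q^ n · ∏₃ m (∏₁ n one)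
jacobiSum-closed zero    zero    t = ℤₚ.+-identityʳ _
jacobiSum-closed zero    (suc n) = begin
  jacobiSum 0 (suc n)
    ≈⟨ jacobiSum-sucʳ 0 n ⟩
  -1ℤ ⊙ q^ 1 · 1-q^ e · jacobiSum 0 n
    ≈⟨ ≗-cong (monomial-multiplier -1ℤ 1) (≗-cong (1-q^-multiplier e) (jacobiSum-closed 0 n)) ⟩
  -1ℤ ⊙ q^ 1 · 1-q^ e · (-1ℤ ^ n) ⊙ q^ n · ∏₁ n one
    ≈⟨ ≗-cong (monomial-multiplier -1ℤ 1) (1-q^-comm (monomial-multiplier (-1ℤ ^ n) n) e (∏₁ n one)) ⟨
  -1ℤ ⊙ q^ 1 · (-1ℤ ^ n) ⊙ q^ n · ∏₁ (suc n) one
    ≈⟨ ⊙q^-⊙q^ -1ℤ 1 (-1ℤ ^ n) n (∏₁ (suc n) one) ⟩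
  (-1ℤ ^ suc n) ⊙ q^ suc n · ∏₁ (suc n) one
    ∎
  where
  open ≗-Reasoning
  e = 1 + 4 ℕ.* n
jacobiSum-closed (suc m) n       = begin
  jacobiSum (suc m) n
    ≈⟨ jacobiSum-sucˡ m n ⟩
  1-q^ e · jacobiSum m n
    ≈⟨ ≗-cong (1-q^-multiplier e) (jacobiSum-closed m n) ⟩
  1-q^ e · (-1ℤ ^ n) ⊙ q^ n · ∏₃ m (∏₁ n one)
    ≈⟨ 1-q^-comm (monomial-multiplier (-1ℤ ^ n) n) e _ ⟨
  (-1ℤ ^ n) ⊙ q^ n · ∏₃ (suc m) (∏₁ n one)
    ∎
  where
  open ≗-Reasoning
  e = 3 + 4 ℕ.* m

mod-4 : ∀ r N → (r + 4 ℕ.* N) % 4 ≡ r % 4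
mod-4 r N = trans (cong (λ x → (r + x) % 4) (ℕₚ.*-comm 4 N)) (DM.[m+kn]%n≡m%n r N 4)

allowed-mod-4 : ∀ r N → Allowed r → Allowed (r + 4 ℕ.* N)
allowed-mod-4 r N allowed eq = allowed (trans (sym (mod-4 r N)) eq)

allowedProduct-split : ∀ N f → allowedProduct (4 ℕ.* N) f ≗ ∏₄ N (∏₃ N (∏₁ N f))
allowedProduct-split zero    f = ≗-refl
allowedProduct-split (suc N) f = begin
  allowedProduct (4 ℕ.* suc N) f
    ≡⟨ cong (λ M → allowedProduct M f) (ℕₚ.*-suc 4 N) ⟩
  factor (4 + 4 ℕ.* N) (factor b (factor (2 + 4 ℕ.* N) (factor a (allowedProduct (4 ℕ.* N) f))))
    ≈⟨ factors (allowedProduct (4 ℕ.* N) f) ⟩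
  1-q^ c · 1-q^ b · 1-q^ a · allowedProduct (4 ℕ.* N) f
    ≈⟨ ≗-cong μ (allowedProduct-split N f) ⟩
  1-q^ c · 1-q^ b · 1-q^ a · ∏₄ N (∏₃ N (∏₁ N f))
    ≈⟨ ≗-cong (1-q^-multiplier c) (≗-trans (1-q^-comm ν b (1-q^ a · ∏₃ N (∏₁ N f)))
                                           (≗-cong (1-q^-multiplier b) (1-q^-comm ν a _))) ⟨
  1-q^ c · ∏₄ N (1-q^ b · 1-q^ a · ∏₃ N (∏₁ N f))
    ≈⟨ ≗-cong (1-q^-multiplier c) (≗-cong ν (≗-cong (1-q^-multiplier b) (1-q^-comm (∏-multiplier _ N) a (∏₁ N f)))) ⟨
  ∏₄ (suc N) (∏₃ (suc N) (∏₁ (suc N) f))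
    ∎
  where
  open ≗-Reasoning
  a = 1 + 4 ℕ.* N
  b = 3 + 4 ℕ.* N
  c = 4 ℕ.* suc N
  μ = ∘-multiplier (1-q^-multiplier c) (∘-multiplier (1-q^-multiplier b) (1-q^-multiplier a))
  ν = ∏-multiplier (λ j → 4 ℕ.* suc j) N
  factors : ∀ g → factor (4 + 4 ℕ.* N) (factor b (factor (2 + 4 ℕ.* N) (factor a g))) ≗ 1-q^ c · 1-q^ b · 1-q^ a · g
  factors g = begin
    factor (4 + 4 ℕ.* N) (factor b (factor (2 + 4 ℕ.* N) (factor a g)))
      ≈⟨ factor-allowed (4 + 4 ℕ.* N) (allowed-mod-4 4 N (λ ())) _ ⟩
    1-q^ (4 + 4 ℕ.* N) · factor b (factor (2 + 4 ℕ.* N) (factor a g))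
      ≡⟨ cong (λ e → 1-q^ e · factor b (factor (2 + 4 ℕ.* N) (factor a g))) (sym (ℕₚ.*-suc 4 N)) ⟩
    1-q^ c · factor b (factor (2 + 4 ℕ.* N) (factor a g))
      ≈⟨ ≗-cong (1-q^-multiplier c) (≗-trans (factor-allowed b (allowed-mod-4 3 N (λ ())) _)
           (≗-cong (1-q^-multiplier b) (≗-trans (factor-forbidden (2 + 4 ℕ.* N) (λ allowed → allowed (mod-4 2 N)) _)
             (factor-allowed a (allowed-mod-4 1 N (λ ())) g)))) ⟩
    1-q^ c · 1-q^ b · 1-q^ a · g
      ∎

thetaTimes : ℕ → Series → Series
thetaTimes N f = sumₛ (N + N) (λ a → (-1ℤ ^ a) ⊙ q^ jacobiExp a N · f)

thetaTimes-cong : ∀ N → f ≗ g → thetaTimes N f ≗ thetaTimes N g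
thetaTimes-cong N f≗g = sumₛ-cong (N + N) (λ a _ → ≗-cong (monomial-multiplier (-1ℤ ^ a) (jacobiExp a N)) f≗g)

thetaTimes-causal : ∀ N → f ≗[< M ] g → thetaTimes N f ≗[< M ] thetaTimes N g
thetaTimes-causal N f≗g = sumₛ-causal (N + N) (λ a _ → causal (monomial-multiplier (-1ℤ ^ a) (jacobiExp a N)) f≗g)

thetaTimes-comm : ∀ {O} → Multiplier O → ∀ N f → O (thetaTimes N f) ≗ thetaTimes N (O f)
thetaTimes-comm μ N f = ≗-trans (sumₛ-comm μ (N + N) _)
                                (sumₛ-cong (N + N) (λ a _ → monomial-comm μ (-1ℤ ^ a) (jacobiExp a N) f))

exponent-bound : ∀ a d → suc ((a + d) + (a + d)) ≤ a + 2 ℕ.* (d ℕ.* d) + 4 ℕ.* suc a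
exponent-bound a d = begin
  suc ((a + d) + (a + d))                         ≡⟨ regroup a d ⟩
  (1 + 2 ℕ.* a) + 2 ℕ.* d                         ≤⟨ ℕₚ.+-monoʳ-≤ (1 + 2 ℕ.* a) (ℕₚ.*-monoʳ-≤ 2 (d≤d*d d)) ⟩
  (1 + 2 ℕ.* a) + 2 ℕ.* (d ℕ.* d)                 ≤⟨ ℕₚ.m≤m+n _ (3 + 3 ℕ.* a) ⟩
  ((1 + 2 ℕ.* a) + 2 ℕ.* (d ℕ.* d)) + (3 + 3 ℕ.* a) ≡⟨ regroup′ a (d ℕ.* d) ⟩
  a + 2 ℕ.* (d ℕ.* d) + 4 ℕ.* suc a               ∎
  where
  open ℕₚ.≤-Reasoning
  d≤d*d : ∀ d → d ≤ d ℕ.* d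
  d≤d*d zero    = z≤n
  d≤d*d (suc d) = ℕₚ.m≤m*n (suc d) (suc d)
  regroup : ∀ a d → suc ((a + d) + (a + d)) ≡ (1 + 2 ℕ.* a) + 2 ℕ.* d
  regroup = ℕ-Solver.solve-∀
  regroup′ : ∀ a s → ((1 + 2 ℕ.* a) + 2 ℕ.* s) + (3 + 3 ℕ.* a) ≡ a + 2 ℕ.* s + 4 ℕ.* suc a
  regroup′ = ℕ-Solver.solve-∀

-- (q⁴;q⁴)_N [2N, a]_{q⁴} is 1 below degree 4 (min a (2N - a)) + 4, and the shift
-- a + 2(a - N)² pushes the rest beyond degree 2N.
∏₄-jacobiTerm : ∀ N a b → a + b ≡ N + N →
  ∏₄ N ((-1ℤ ^ a) ⊙ q^ jacobiExp a N · gauss a b) ≗[< suc (N + N) ] (-1ℤ ^ a) ⊙ q^ jacobiExp a N · one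
∏₄-jacobiTerm N a b a+b≡2N with ℕₚ.≤-total a N
... | inj₁ a≤N = ≗[<]-trans (≗⇒≗[<] (monomial-comm ν (-1ℤ ^ a) (jacobiExp a N) (gauss a b)))
                   (≗[<]-weaken bound (monomial-causal (-1ℤ ^ a) (jacobiExp a N)
                     (≗[<]-trans (≗⇒≗[<] (≗-cong ν (gauss-sym a b)))
                                 (∏₄-gauss a≤N (ℕₚ.*-monoʳ-≤ 4 (s≤s a≤b)) ℕₚ.≤-refl))))
  where
  ν = ∏-multiplier (λ j → 4 ℕ.* suc j) N
  a≤b : a ≤ b
  a≤b = ℕₚ.+-cancelˡ-≤ a a b (ℕₚ.≤-trans (ℕₚ.+-mono-≤ a≤N a≤N) (ℕₚ.≤-reflexive (sym a+b≡2N)))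
  N≡a+[N∸a] : N ≡ a + (N ∸ a)
  N≡a+[N∸a] = sym (ℕₚ.m+[n∸m]≡n a≤N)
  bound : suc (N + N) ≤ jacobiExp a N + 4 ℕ.* suc a
  bound = ℕₚ.≤-trans (ℕₚ.≤-reflexive (cong (λ x → suc (x + x)) N≡a+[N∸a]))
            (ℕₚ.≤-trans (exponent-bound a (N ∸ a))
              (ℕₚ.≤-reflexive (cong (λ x → a + 2 ℕ.* (x ℕ.* x) + 4 ℕ.* suc a) (sym (ℕₚ.m≤n⇒∣m-n∣≡n∸m a≤N)))))
... | inj₂ N≤a = ≗[<]-trans (≗⇒≗[<] (monomial-comm ν (-1ℤ ^ a) (jacobiExp a N) (gauss a b)))
                   (≗[<]-weaken bound (monomial-causal (-1ℤ ^ a) (jacobiExp a N)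
                     (∏₄-gauss b≤N (ℕₚ.*-monoʳ-≤ 4 (s≤s b≤a)) ℕₚ.≤-refl)))
  where
  ν = ∏-multiplier (λ j → 4 ℕ.* suc j) N
  b≤N : b ≤ N
  b≤N = ℕₚ.+-cancelˡ-≤ N b N (ℕₚ.≤-trans (ℕₚ.+-monoˡ-≤ b N≤a)
          (ℕₚ.≤-reflexive a+b≡2N))
  b≤a : b ≤ a
  b≤a = ℕₚ.≤-trans b≤N N≤a
  bound : suc (N + N) ≤ jacobiExp a N + 4 ℕ.* suc b
  bound = ℕₚ.≤-trans (ℕₚ.≤-reflexive (trans (cong suc (sym a+b≡2N)) (sym (ℕₚ.+-suc a b))))
            (ℕₚ.+-mono-≤ (ℕₚ.m≤m+n a (2 ℕ.* sqDist a N)) (ℕₚ.m≤n*m (suc b) 4))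

-- Multiplied by allowedProduct (4N) = (q⁴;q⁴)_N (q³;q⁴)_N (q;q⁴)_N, the left side becomes
-- Σ_a (-1)ᵃ q^{a + 2(a-N)²}, and the right side (q⁴;q⁴)_N times the finite triple product.
thetaTimes-partitions : ∀ N → thetaTimes N (partitionSeries (4 ℕ.* N)) ≗[< suc (N + N) ] (-1ℤ ^ N) ⊙ q^ N · one
thetaTimes-partitions N = allowedProduct-injective M₄
  (≗[<]-trans (≗⇒≗[<] theta) (≗[<]-trans (≗[<]-sym truncated) (≗⇒≗[<] product)))
  where
  M₄ = 4 ℕ.* N
  ν = ∏-multiplier (λ j → 4 ℕ.* suc j) N
  theta : allowedProduct M₄ (thetaTimes N (partitionSeries M₄)) ≗ thetaTimes N one
  theta = ≗-trans (thetaTimes-comm (allowedProduct-multiplier M₄) N (partitionSeries M₄))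
                  (thetaTimes-cong N (allowedProduct-partitionSeries M₄))
  truncated : ∏₄ N (jacobiSum N N) ≗[< suc (N + N) ] thetaTimes N one
  truncated = ≗[<]-trans (≗⇒≗[<] (sumₛ-comm ν (N + N) (jacobiTerm N N)))
                (sumₛ-causal (N + N) (λ a a≤2N → ∏₄-jacobiTerm N a (N + N ∸ a) (ℕₚ.m+[n∸m]≡n a≤2N)))
  product : ∏₄ N (jacobiSum N N) ≗ allowedProduct M₄ ((-1ℤ ^ N) ⊙ q^ N · one)
  product = begin
    ∏₄ N (jacobiSum N N)
      ≈⟨ ≗-cong ν (jacobiSum-closed N N) ⟩
    ∏₄ N ((-1ℤ ^ N) ⊙ q^ N · ∏₃ N (∏₁ N one))
      ≈⟨ monomial-comm ν (-1ℤ ^ N) N _ ⟩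
    (-1ℤ ^ N) ⊙ q^ N · ∏₄ N (∏₃ N (∏₁ N one))
      ≈⟨ ≗-cong (monomial-multiplier (-1ℤ ^ N) N) (allowedProduct-split N one) ⟨
    (-1ℤ ^ N) ⊙ q^ N · allowedProduct M₄ one
      ≈⟨ monomial-comm (allowedProduct-multiplier M₄) (-1ℤ ^ N) N one ⟨
    allowedProduct M₄ ((-1ℤ ^ N) ⊙ q^ N · one)
      ∎
    where open ≗-Reasoning

-1^-double : ∀ k → -1ℤ ^ (2 ℕ.* k) ≡ 1ℤ
-1^-double k = trans (sym (ℤₚ.^-*-assoc -1ℤ 2 k)) (ℤₚ.^-zeroˡ k)

-1^-parity : ∀ a k → -1ℤ ^ (a + 2 ℕ.* k) ≡ -1ℤ ^ a
-1^-parity a k = trans (ℤₚ.^-distribˡ-+-* -1ℤ a (2 ℕ.* k))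
                       (trans (cong (-1ℤ ^ a *_) (-1^-double k)) (ℤₚ.*-identityʳ (-1ℤ ^ a)))

sgn≡-1^ : ∀ e → sgn e ≡ -1ℤ ^ e
sgn≡-1^ zero          = refl
sgn≡-1^ (suc zero)    = refl
sgn≡-1^ (suc (suc e)) = begin
  sgn (2 + e)         ≡⟨ sgn-mod-2 (2 + e) e (trans (cong (_% 2) (ℕₚ.+-comm 2 e)) (DM.[m+n]%n≡m%n e 2)) ⟩
  sgn e               ≡⟨ sgn≡-1^ e ⟩
  -1ℤ ^ e             ≡⟨ -1^-parity e 1 ⟨
  -1ℤ ^ (e + 2)       ≡⟨ cong (-1ℤ ^_) (ℕₚ.+-comm e 2) ⟩
  -1ℤ ^ (2 + e)       ∎
  where
  open ≡-Reasoning
  sgn-mod-2 : ∀ e e′ → e % 2 ≡ e′ % 2 → sgn e ≡ sgn e′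
  sgn-mod-2 e e′ eq with e % 2 | e′ % 2 | eq
  ... | r | .r | refl = refl

-1^-square : ∀ k → -1ℤ ^ k * -1ℤ ^ k ≡ 1ℤ
-1^-square k = trans (sym (ℤₚ.^-distribˡ-+-* -1ℤ k k))
                     (trans (cong (λ n → -1ℤ ^ (k + n)) (sym (ℕₚ.+-identityʳ k))) (-1^-double k))

tri-even : ∀ d → tri (d + d) ≡ d + 2 ℕ.* (d ℕ.* d)
tri-even d = trans (cong (ℕ._/ 2) (double d)) (DM.m*n/n≡m (d + 2 ℕ.* (d ℕ.* d)) 2)
  where
  double : ∀ d → (d + d) ℕ.* suc (d + d) ≡ (d + 2 ℕ.* (d ℕ.* d)) ℕ.* 2
  double = ℕ-Solver.solve-∀

tri-odd : ∀ e → tri (e + suc e) ≡ (e + suc e) ℕ.* suc e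
tri-odd e = trans (cong (ℕ._/ 2) (double e)) (DM.m*n/n≡m ((e + suc e) ℕ.* suc e) 2)
  where
  double : ∀ e → (e + suc e) ℕ.* suc (e + suc e) ≡ ((e + suc e) ℕ.* suc e) ℕ.* 2
  double = ℕ-Solver.solve-∀

tri-≥ : ∀ k → k ≤ tri k
tri-≥ zero    = z≤n
tri-≥ (suc k) = ℕₚ.≤-trans (ℕₚ.≤-reflexive (sym (DM.m*n/n≡m (suc k) 2)))
                           (DM./-monoˡ-≤ {suc k ℕ.* 2} {suc k ℕ.* suc (suc k)} 2 (ℕₚ.*-monoʳ-≤ (suc k) (s≤s (s≤s z≤n))))

-- The coefficient of q^{2N}

C4series : Series
C4series t = + C4 t

q^-C4series : ∀ e t → (q^ e · C4series) t ≡ + C4ℤ (+ t - + e)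
q^-C4series zero    t       = cong (λ i → + C4ℤ i) (sym (ℤₚ.+-identityʳ (+ t)))
q^-C4series (suc e) zero    = refl
q^-C4series (suc e) (suc t) = trans (q^-C4series e t) (cong (λ i → + C4ℤ i) (sym shift))
  where
  shift : + suc t - + suc e ≡ + t - + e
  shift = trans (ℤₚ.[1+m]⊖[1+n]≡m⊖n t e) (sym (ℤₚ.[+m]-[+n]≡m⊖n t e))

coefficientTerm : ℕ → ℕ → ℤ
coefficientTerm N a = -1ℤ ^ a * + C4ℤ (+ (N + N) - + jacobiExp a N)

theta-C4-coefficient : ∀ N → 1 ≤ N → sum≤ (N + N) (coefficientTerm N) ≡ 0ℤ
theta-C4-coefficient N@(suc _) _ = begin
  sum≤ (N + N) (coefficientTerm N)                    ≡⟨ sum≤-cong (N + N) (λ a _ → cong (-1ℤ ^ a *_)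
                                                           (sym (q^-C4series (jacobiExp a N) (N + N)))) ⟩
  thetaTimes N C4series (N + N)                       ≡⟨ thetaTimes-causal N C4-truncation (N + N) 2N<4N+1 ⟨
  thetaTimes N (partitionSeries (4 ℕ.* N)) (N + N)    ≡⟨ thetaTimes-partitions N (N + N) ℕₚ.≤-refl ⟩
  -1ℤ ^ N * (q^ N · one) (N + N)                      ≡⟨ cong (-1ℤ ^ N *_) (q^-at N one N) ⟩
  -1ℤ ^ N * 0ℤ                                        ≡⟨ ℤₚ.*-zeroʳ (-1ℤ ^ N) ⟩
  0ℤ                                                  ∎
  where
  open ≡-Reasoning
  C4-truncation : partitionSeries (4 ℕ.* N) ≗[< suc (4 ℕ.* N) ] C4series
  C4-truncation t (s≤s t≤4N) = partitionSeries-C4 t≤4N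
  2N<4N+1 : N + N < suc (4 ℕ.* N)
  2N<4N+1 = s≤s (ℕₚ.≤-trans (ℕₚ.m≤m+n (N + N) (N + N)) (ℕₚ.≤-reflexive (double-double N)))
    where
    double-double : ∀ N → (N + N) + (N + N) ≡ 4 ℕ.* N
    double-double = ℕ-Solver.solve-∀

recurrenceTerm : ℕ → ℕ → ℤ
recurrenceTerm N k = sgn (tri k + 1) * + C4ℤ (+ N - + tri k)

C4ℤ-cancel : ∀ N T → + C4ℤ (+ (N + N) - + (N + T)) ≡ + C4ℤ (+ N - + T)
C4ℤ-cancel N T = cong (λ i → + C4ℤ i) (begin
  + (N + N) - + (N + T) ≡⟨ ℤₚ.[+m]-[+n]≡m⊖n (N + N) (N + T) ⟩
  (N + N) ℤ.⊖ (N + T)   ≡⟨ ℤₚ.+-cancelˡ-⊖ N N T ⟩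
  N ℤ.⊖ T               ≡⟨ ℤₚ.[+m]-[+n]≡m⊖n N T ⟨
  + N - + T             ∎)
  where open ≡-Reasoning

coefficientTerm-as-recurrenceTerm : ∀ N a k → jacobiExp a N ≡ N + tri k → -1ℤ ^ a ≡ -1ℤ ^ N * - sgn (tri k + 1) →
  coefficientTerm N a ≡ - (-1ℤ ^ N) * recurrenceTerm N k
coefficientTerm-as-recurrenceTerm N a k exp sign = begin
  -1ℤ ^ a * + C4ℤ (+ (N + N) - + jacobiExp a N)
    ≡⟨ cong₂ (λ s e → s * + C4ℤ (+ (N + N) - + e)) sign exp ⟩
  (-1ℤ ^ N * - sgn (tri k + 1)) * + C4ℤ (+ (N + N) - + (N + tri k))
    ≡⟨ cong ((-1ℤ ^ N * - sgn (tri k + 1)) *_) (C4ℤ-cancel N (tri k)) ⟩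
  (-1ℤ ^ N * - sgn (tri k + 1)) * + C4ℤ (+ N - + tri k)
    ≡⟨ regroup (-1ℤ ^ N) (sgn (tri k + 1)) _ ⟩
  - (-1ℤ ^ N) * recurrenceTerm N k
    ∎
  where
  open ≡-Reasoning
  regroup : ∀ s g c → (s * - g) * c ≡ - s * (g * c)
  regroup = ℤ-Solver.solve-∀

jacobiExp-above : ∀ N d → jacobiExp (N + d) N ≡ N + tri (d + d)
jacobiExp-above N d = begin
  (N + d) + 2 ℕ.* sqDist (N + d) N ≡⟨ cong (λ x → (N + d) + 2 ℕ.* (x ℕ.* x)) ∣N+d-N∣≡d ⟩
  (N + d) + 2 ℕ.* (d ℕ.* d)        ≡⟨ ℕₚ.+-assoc N d _ ⟩
  N + (d + 2 ℕ.* (d ℕ.* d))        ≡⟨ cong (λ x → N + x) (tri-even d) ⟨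
  N + tri (d + d)                  ∎
  where
  open ≡-Reasoning
  ∣N+d-N∣≡d : ∣ N + d - N ∣ ≡ d
  ∣N+d-N∣≡d = trans (ℕₚ.∣-∣-comm (N + d) N) (ℕₚ.∣m-m+n∣≡n N d)

jacobiExp-below : ∀ N e → suc e ≤ N → jacobiExp (N ∸ suc e) N ≡ N + tri (e + suc e)
jacobiExp-below N e e<N = begin
  r + 2 ℕ.* sqDist r N                        ≡⟨ cong (λ x → r + 2 ℕ.* (x ℕ.* x)) ∣r-N∣≡suc-e ⟩
  r + 2 ℕ.* (suc e ℕ.* suc e)                 ≡⟨ regroup r e ⟩
  (r + suc e) + (e + suc e) ℕ.* suc e         ≡⟨ cong₂ _+_ (ℕₚ.m∸n+n≡m e<N) (sym (tri-odd e)) ⟩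
  N + tri (e + suc e)                         ∎
  where
  open ≡-Reasoning
  r = N ∸ suc e
  ∣r-N∣≡suc-e : ∣ r - N ∣ ≡ suc e
  ∣r-N∣≡suc-e = trans (ℕₚ.m≤n⇒∣m-n∣≡n∸m (ℕₚ.m∸n≤m N (suc e))) (ℕₚ.m∸[m∸n]≡n e<N)
  regroup : ∀ r e → r + 2 ℕ.* (suc e ℕ.* suc e) ≡ (r + suc e) + (e + suc e) ℕ.* suc e
  regroup = ℕ-Solver.solve-∀

sign-above : ∀ N d → -1ℤ ^ (N + d) ≡ -1ℤ ^ N * - sgn (tri (d + d) + 1)
sign-above N d = begin
  -1ℤ ^ (N + d)                      ≡⟨ ℤₚ.^-distribˡ-+-* -1ℤ N d ⟩
  -1ℤ ^ N * -1ℤ ^ d                  ≡⟨ cong (-1ℤ ^ N *_) (ℤₚ.neg-involutive (-1ℤ ^ d)) ⟨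
  -1ℤ ^ N * - - (-1ℤ ^ d)            ≡⟨ cong (λ s → -1ℤ ^ N * - s) sgn-tri ⟩
  -1ℤ ^ N * - sgn (tri (d + d) + 1)  ∎
  where
  open ≡-Reasoning
  sgn-tri : - (-1ℤ ^ d) ≡ sgn (tri (d + d) + 1)
  sgn-tri = begin
    - (-1ℤ ^ d)                       ≡⟨ ℤₚ.-1*i≡-i (-1ℤ ^ d) ⟨
    -1ℤ ^ suc d                       ≡⟨ -1^-parity (suc d) (d ℕ.* d) ⟨
    -1ℤ ^ (suc d + 2 ℕ.* (d ℕ.* d))   ≡⟨ cong (λ n → -1ℤ ^ (suc n)) (sym (tri-even d)) ⟩
    -1ℤ ^ suc (tri (d + d))           ≡⟨ cong (-1ℤ ^_) (ℕₚ.+-comm 1 (tri (d + d))) ⟩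
    -1ℤ ^ (tri (d + d) + 1)           ≡⟨ sgn≡-1^ (tri (d + d) + 1) ⟨
    sgn (tri (d + d) + 1)             ∎

sign-below : ∀ N e → suc e ≤ N → -1ℤ ^ (N ∸ suc e) ≡ -1ℤ ^ N * - sgn (tri (e + suc e) + 1)
sign-below N e e<N = begin
  x                                      ≡⟨ ℤₚ.*-identityʳ x ⟨
  x * 1ℤ                                 ≡⟨ cong (x *_) (-1^-square e) ⟨
  x * (y * y)                            ≡⟨ regroup x y ⟩
  (x * -1ℤ ^ suc e) * - y                ≡⟨ cong (_* - y) (ℤₚ.^-distribˡ-+-* -1ℤ (N ∸ suc e) (suc e)) ⟨
  -1ℤ ^ (N ∸ suc e + suc e) * - y        ≡⟨ cong (λ n → -1ℤ ^ n * - y) (ℕₚ.m∸n+n≡m e<N) ⟩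
  -1ℤ ^ N * - y                          ≡⟨ cong (λ s → -1ℤ ^ N * - s) sgn-tri ⟩
  -1ℤ ^ N * - sgn (tri (e + suc e) + 1)  ∎
  where
  open ≡-Reasoning
  x = -1ℤ ^ (N ∸ suc e)
  y = -1ℤ ^ e
  regroup : ∀ x y → x * (y * y) ≡ (x * (- + 1 * y)) * - y
  regroup = ℤ-Solver.solve-∀
  sgn-tri : y ≡ sgn (tri (e + suc e) + 1)
  sgn-tri = begin
    -1ℤ ^ e                              ≡⟨ -1^-parity e (e ℕ.* e + e + 1) ⟨
    -1ℤ ^ (e + 2 ℕ.* (e ℕ.* e + e + 1))  ≡⟨ cong (-1ℤ ^_) (expand e) ⟩
    -1ℤ ^ ((e + suc e) ℕ.* suc e + 1)    ≡⟨ cong (λ n → -1ℤ ^ (n + 1)) (tri-odd e) ⟨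
    -1ℤ ^ (tri (e + suc e) + 1)          ≡⟨ sgn≡-1^ (tri (e + suc e) + 1) ⟨
    sgn (tri (e + suc e) + 1)            ∎
    where
    expand : ∀ e → e + 2 ℕ.* (e ℕ.* e + e + 1) ≡ (e + suc e) ℕ.* suc e + 1
    expand = ℕ-Solver.solve-∀

coefficientSum-as-recurrenceSum : ∀ N →
  sum≤ (N + N) (coefficientTerm N) ≡ -1ℤ ^ N * + C4 N ℤ.+ - (-1ℤ ^ N) * sumFrom1 (N + N) (recurrenceTerm N)
coefficientSum-as-recurrenceSum N = begin
  sum≤ (N + N) u
    ≡⟨ sum≤-around-middle N u ⟩
  u N ℤ.+ sumFrom1 N (λ d → u (N ∸ d) ℤ.+ u (N + d))
    ≡⟨ cong₂ ℤ._+_ middle (sumFrom1-cong N pair) ⟩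
  s * + C4 N ℤ.+ sumFrom1 N (λ d → - s * (r (pred (d + d)) ℤ.+ r (d + d)))
    ≡⟨ cong (λ x → s * + C4 N ℤ.+ x) (sumFrom1-* N (- s) _) ⟩
  s * + C4 N ℤ.+ - s * sumFrom1 N (λ d → r (pred (d + d)) ℤ.+ r (d + d))
    ≡⟨ cong (λ x → s * + C4 N ℤ.+ - s * x) (sumFrom1-pairs N r) ⟨
  s * + C4 N ℤ.+ - s * sumFrom1 (N + N) r
    ∎
  where
  open ≡-Reasoning
  s = -1ℤ ^ N
  u = coefficientTerm N
  r = recurrenceTerm N
  middle : u N ≡ s * + C4 N
  middle = cong (s *_) (begin
    + C4ℤ (+ (N + N) - + (N + 2 ℕ.* sqDist N N)) ≡⟨ cong (λ x → + C4ℤ (+ (N + N) - + (N + 2 ℕ.* (x ℕ.* x))))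
                                                         (ℕₚ.∣n-n∣≡0 N) ⟩
    + C4ℤ (+ (N + N) - + (N + 0))                ≡⟨ C4ℤ-cancel N 0 ⟩
    + C4ℤ (+ N - + 0)                            ≡⟨ cong (λ i → + C4ℤ i) (ℤₚ.+-identityʳ (+ N)) ⟩
    + C4 N                                       ∎)
  pair : ∀ d → 1 ≤ d → d ≤ N → u (N ∸ d) ℤ.+ u (N + d) ≡ - s * (r (pred (d + d)) ℤ.+ r (d + d))
  pair d@(suc e) _ d≤N = begin
    u (N ∸ d) ℤ.+ u (N + d)                 ≡⟨ cong₂ ℤ._+_
                                                 (coefficientTerm-as-recurrenceTerm N (N ∸ d) (e + suc e)
                                                    (jacobiExp-below N e d≤N) (sign-below N e d≤N))
                                                 (coefficientTerm-as-recurrenceTerm N (N + d) (d + d)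
                                                    (jacobiExp-above N d) (sign-above N d)) ⟩
    - s * r (e + suc e) ℤ.+ - s * r (d + d) ≡⟨ ℤₚ.*-distribˡ-+ (- s) (r (e + suc e)) (r (d + d)) ⟨
    - s * (r (pred (d + d)) ℤ.+ r (d + d))  ∎

C4-recurrence-2N : ∀ N → 1 ≤ N → + C4 N ≡ sumFrom1 (N + N) (recurrenceTerm N)
C4-recurrence-2N N 1≤N = ℤₚ.i-j≡0⇒i≡j (+ C4 N) Σr (begin
  + C4 N - Σr                          ≡⟨ ℤₚ.*-identityˡ _ ⟨
  1ℤ * (+ C4 N - Σr)                   ≡⟨ cong (_* (+ C4 N - Σr)) (-1^-square N) ⟨
  (s * s) * (+ C4 N - Σr)              ≡⟨ regroup s (+ C4 N) Σr ⟩
  s * (s * + C4 N ℤ.+ - s * Σr)        ≡⟨ cong (s *_) (coefficientSum-as-recurrenceSum N) ⟨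
  s * sum≤ (N + N) (coefficientTerm N) ≡⟨ cong (s *_) (theta-C4-coefficient N 1≤N) ⟩
  s * 0ℤ                               ≡⟨ ℤₚ.*-zeroʳ s ⟩
  0ℤ                                   ∎)
  where
  open ≡-Reasoning
  s = -1ℤ ^ N
  Σr = sumFrom1 (N + N) (recurrenceTerm N)
  regroup : ∀ s c σ → (s * s) * (c - σ) ≡ s * (s * c ℤ.+ - s * σ)
  regroup = ℤ-Solver.solve-∀

recurrenceTerm-vanishes : ∀ N k → N < k → recurrenceTerm N k ≡ 0ℤ
recurrenceTerm-vanishes N k N<k = begin
  sgn (tri k + 1) * + C4ℤ (+ N - + tri k)  ≡⟨ cong (sgn (tri k + 1) *_) (sym (q^-C4series (tri k) N)) ⟩
  sgn (tri k + 1) * (q^ tri k · C4series) N ≡⟨ cong (sgn (tri k + 1) *_) (q^-below (ℕₚ.<-≤-trans N<k (tri-≥ k))) ⟩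
  sgn (tri k + 1) * 0ℤ                     ≡⟨ ℤₚ.*-zeroʳ (sgn (tri k + 1)) ⟩
  0ℤ                                       ∎
  where open ≡-Reasoning

theorem9 : ∀ (n : ℕ) → 1 ≤ n →
    + C4 n ≡ sumFrom1 n (λ k → sgn (tri k + 1) * + C4ℤ (+ n - + tri k))
theorem9 n 1≤n = begin
  + C4 n                                ≡⟨ C4-recurrence-2N n 1≤n ⟩
  sumFrom1 (n + n) (recurrenceTerm n)   ≡⟨ sumFrom1-extend n n (recurrenceTerm n)
                                             (λ d 1≤d _ → recurrenceTerm-vanishes n (n + d) (ℕₚ.m<m+n n 1≤d)) ⟩
  sumFrom1 n (recurrenceTerm n)         ∎
  where open ≡-Reasoning
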